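{- Let $G$ be a (simple, undirected) graph on $n$ vertices with connectivity $k(G)$ satisfying $k(G)\geq\frac{n-1}{2}$. Then for any two adjacent vertices $x$ and $y$ with $d_x\geq d_y$, $$\kappa_{LLY}(x,y)\geq\frac{2k(G)-n+2}{d_x}.$$
   Context: The connectivity $k(G)$ of a non-complete graph is the minimum number of vertices whose removal disconnects $G$; for the complete graph $K_n$ it is $n-1$. $d(x,y)$ is the graph distance and $d_x$ the degree of $x$. For $p\in[0,1]$ and a vertex $x$, $\mu_x^p$ is the probability measure with $\mu_x^p(x)=p$, $\mu_x^p(y)=\frac{1-p}{d_x}$ if $y$ is adjacent to $x$, and $0$ otherwise. For probability measures $\mu_1,\mu_2$ on $V$, $W(\mu_1,\mu_2)=\inf_\pi\sum_{x,y}d(x,y)\pi(x,y)$ over all $\pi:V\times V\to[0,1]$ with marginals $\mu_1$ and $\mu_2$. For distinct vertices $x,y$, $\kappa_p(x,y)=1-\frac{W(\mu_x^p,\mu_y^p)}{d(x,y)}$ and $\kappa_{LLY}(x,y)=\lim_{p\to1}\frac{\kappa_p(x,y)}{1-p}$. -}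

module Defs where

open import Data.Bool using (Bool; true; false; T; if_then_else_; _∧_; _∨_; not)
open import Data.Nat as ℕ using (ℕ; zero; suc)
open import Data.Fin using (Fin)
open import Data.Fin.Subset using (Subset; _∈_; _∉_; ∣_∣)
open import Data.List using (List; map; foldr; allFin)
open import Data.Bool.ListAction using (any)
open import Data.Product using (Σ; _×_; ∃; ∃-syntax; _,_)
open import Data.Integer using (ℤ; +_)
open import Data.Rational using (ℚ; _/_; 0ℚ; 1ℚ; _+_; _*_; _-_; _≤_)
open import Relation.Binary.PropositionalEquality using (_≡_)
open import Relation.Nullary using (¬_; does; yes; no)
open import Data.Fin using (_≟_)

record Graph (n : ℕ) : Set where
  field
    adj     : Fin n → Fin n → Bool
    adj-sym : ∀ u v → adj u v ≡ adj v u
    irrefl  : ∀ u → adj u u ≡ false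
open Graph public

module _ {n : ℕ} (G : Graph n) where

  deg : Fin n → ℕ
  deg x = foldr ℕ._+_ 0 (map (λ w → if adj G x w then 1 else 0) (allFin n))

  data PathAvoid (S : Subset n) : Fin n → Fin n → Set where
    here : ∀ {u} → u ∉ S → PathAvoid S u u
    step : ∀ {u w v} → u ∉ S → T (adj G u w) → PathAvoid S w v → PathAvoid S u v

  Disconnects : Subset n → Set
  Disconnects S = ∃[ u ] ∃[ v ] (u ∉ S × v ∉ S × ¬ PathAvoid S u v)

  IsComplete : Set
  IsComplete = ∀ u v → ¬ (u ≡ v) → T (adj G u v)

  IsConnectivity : ℕ → Set
  IsConnectivity k =
    (IsComplete → k ≡ n ℕ.∸ 1) ×
    (¬ IsComplete →
       (∃[ S ] (Disconnects S × ∣ S ∣ ≡ k)) ×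
       (∀ S → Disconnects S → k ℕ.≤ ∣ S ∣))

  reach : ℕ → Fin n → Fin n → Bool
  reach zero    u v = does (u ≟ v)
  reach (suc m) u v = reach m u v ∨ any (λ w → adj G u w ∧ reach m w v) (allFin n)

  -- graph distance: least m ≤ n with reach m u v (value n if unreachable,
  -- which never occurs in connected graphs)
  distFrom : ℕ → ℕ → Fin n → Fin n → ℕ
  distFrom m zero    u v = m
  distFrom m (suc f) u v = if reach m u v then m else distFrom (suc m) f u v

  dist : Fin n → Fin n → ℕ
  dist = distFrom 0 n

  ℕtoℚ : ℕ → ℚ
  ℕtoℚ m = (+ m) / 1

  inv : ℕ → ℚ
  inv zero    = 0ℚ
  inv (suc k) = (+ 1) / suc k

  sumℚ : (Fin n → ℚ) → ℚ
  sumℚ f = foldr _+_ 0ℚ (map f (allFin n))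

  μ : ℚ → Fin n → Fin n → ℚ
  μ p x v with x ≟ v
  ... | yes _ = p
  ... | no _  = if adj G x v then (1ℚ - p) * inv (deg x) else 0ℚ

  IsCoupling : (Fin n → ℚ) → (Fin n → ℚ) → (Fin n → Fin n → ℚ) → Set
  IsCoupling μ₁ μ₂ π =
    (∀ u v → 0ℚ ≤ π u v) × (∀ u v → π u v ≤ 1ℚ) ×
    (∀ u → sumℚ (λ v → π u v) ≡ μ₁ u) ×
    (∀ v → sumℚ (λ u → π u v) ≡ μ₂ v)

  cost : (Fin n → Fin n → ℚ) → ℚ
  cost π = sumℚ (λ u → sumℚ (λ v → ℕtoℚ (dist u v) * π u v))

-- For every p ≥ 1/2 we exhibit an explicit transport plan from μ_x^p to μ_y^p.  The mass
-- min(μ_x^p, μ_y^p) stays at x, at y and at the common neighbours of x and y; x sends its surplus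
-- p - (1-p)/d_y to y; and the private neighbours N(x) ∖ N[y] of x are matched along edges to
-- private neighbours N(y) ∖ N[x] of y, each match moving (1-p)/d_x over distance 1.  The rest is
-- coupled arbitrarily: since k(G) ≥ (n-1)/2, any two non-adjacent vertices have a common
-- neighbour, so it travels distance at most 2.
--
-- The matching comes from Hall's theorem with deficiency n - k - 1 - |N(y) ∖ N[x]|.  If a set X of
-- private neighbours of x violated Hall's condition, then removing every vertex outside X, y and
-- the private neighbours of y not adjacent to X would separate X from y with fewer than k vertices.
-- Counting degrees then gives d_x + 2k ≤ n + 1 + 2|N(x) ∩ N(y)| + |matching|, which is exactly the
-- slack needed for W(μ_x^p, μ_y^p) ≤ 1 - (1-p)(2k + 2 - n)/d_x.

module Submission where

module FiniteSums where

  open import Algebra.Bundles using (CommutativeMonoid)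
  open import Data.Fin using (Fin; zero; suc)
  open import Data.Fin.Properties using (suc-injective)
  open import Data.List as List using (List)
  open import Data.Nat using (zero; suc)
  import Data.Vec.Functional as Vector
  open import Function using (_∘_)
  open import Relation.Binary.PropositionalEquality using (_≡_; refl; cong)
  open import Relation.Nullary using (¬_)

  foldr-tabulate : ∀ {A B : Set} (f : A → B → B) (z : B) {n} (g : Fin n → A) →
                   List.foldr f z (List.tabulate g) ≡ Vector.foldr f z g
  foldr-tabulate f z {zero}  g = refl
  foldr-tabulate f z {suc n} g = cong (f (g zero)) (foldr-tabulate f z (g ∘ suc))

  module CommutativeMonoidSum {a ℓ} (M : CommutativeMonoid a ℓ) where

    open CommutativeMonoid M renaming (_∙_ to _+_; ε to 0#; ∙-cong to +-cong; refl to ≈-refl; trans to ≈-trans)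
    open import Algebra.Properties.CommutativeMonoid.Sum M public

    sum-zero : ∀ {n} {f : Fin n → Carrier} → (∀ i → f i ≈ 0#) → sum f ≈ 0#
    sum-zero {zero}  f≈0 = ≈-refl
    sum-zero {suc n} f≈0 = ≈-trans (+-cong (f≈0 zero) (sum-zero (f≈0 ∘ suc))) (identityˡ 0#)

    sum-single : ∀ {n} {f : Fin n → Carrier} (j : Fin n) →
                 (∀ i → ¬ i ≡ j → f i ≈ 0#) → sum f ≈ f j
    sum-single {suc n} zero    f≈0 =
      ≈-trans (+-cong ≈-refl (sum-zero (λ i → f≈0 (suc i) λ ()))) (identityʳ _)
    sum-single {suc n} (suc j) f≈0 =
      ≈-trans (+-cong (f≈0 zero λ ()) (sum-single j (λ i i≢j → f≈0 (suc i) (i≢j ∘ suc-injective))))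
            (identityˡ _)

module Counting where

  open import Data.Bool using (Bool; true; false; T; if_then_else_; _∧_; _∨_; not)
  open import Data.Bool.Properties using (T-∧; T-∨; ∨-inverseʳ)
  open import Data.Empty using (⊥-elim)
  open import Data.Fin using (Fin; zero; suc; _≟_)
  open import Data.Fin.Properties using (any?)
  open import Data.Nat using (ℕ; zero; suc; _+_; _≤_; _<_; z≤n; s≤s)
  open import Data.Nat.Properties as ℕ using (+-0-commutativeMonoid)
  open import Data.Product using (∃; _,_; proj₁; proj₂)
  open import Data.Sum using ([_,_]′)
  open import Data.Unit using (tt)
  open import Function using (_∘_)
  open import Function.Bundles using (module Equivalence)
  open import Relation.Binary.PropositionalEquality using (_≡_; refl; sym; trans; cong; subst; module ≡-Reasoning)
  open import Relation.Nullary using (¬_; yes; no; contradiction)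
  open import Relation.Nullary.Decidable using (⌊_⌋; T?; toWitness; fromWitness)

  open FiniteSums
  open CommutativeMonoidSum +-0-commutativeMonoid
    using (sum; sum-cong-≗; ∑-distrib-+; sum-zero; sum-single)
  open Equivalence using (to; from)

  private
    variable
      n : ℕ

  T-not⁺ : ∀ {b} → ¬ T b → T (not b)
  T-not⁺ {true}  ¬b = ¬b tt
  T-not⁺ {false} _  = tt

  T-not⁻ : ∀ {b} → T (not b) → ¬ T b
  T-not⁻ {true} ()

  infixr 7 _∩_
  infixr 6 _∪_ _─_

  _∪_ _∩_ _─_ : (P Q : Fin n → Bool) → Fin n → Bool
  (P ∪ Q) i = P i ∨ Q i
  (P ∩ Q) i = P i ∧ Q i
  (P ─ Q) i = P i ∧ not (Q i)

  ∁ : (Fin n → Bool) → Fin n → Bool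
  ∁ P i = not (P i)

  ⁅_⁆ : Fin n → Fin n → Bool
  ⁅ j ⁆ i = ⌊ i ≟ j ⌋

  _⊆_ : (P Q : Fin n → Bool) → Set
  P ⊆ Q = ∀ i → T (P i) → T (Q i)

  Disjoint : (P Q : Fin n → Bool) → Set
  Disjoint P Q = ∀ i → T (P i) → ¬ T (Q i)

  ∈⁅⁆⇒≡ : ∀ {i j : Fin n} → T (⁅ j ⁆ i) → i ≡ j
  ∈⁅⁆⇒≡ {i = i} {j} = toWitness {a? = i ≟ j}

  ≡⇒∈⁅⁆ : ∀ {i j : Fin n} → i ≡ j → T (⁅ j ⁆ i)
  ≡⇒∈⁅⁆ {i = i} {j} = fromWitness {a? = i ≟ j}

  ⊆-trans : ∀ {P Q R : Fin n → Bool} → P ⊆ Q → Q ⊆ R → P ⊆ R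
  ⊆-trans P⊆Q Q⊆R i = Q⊆R i ∘ P⊆Q i

  ∪-least : ∀ {P Q R : Fin n → Bool} → P ⊆ R → Q ⊆ R → (P ∪ Q) ⊆ R
  ∪-least {P = P} P⊆R Q⊆R i = [ P⊆R i , Q⊆R i ]′ ∘ T-∨ {P i} .to

  ─-⊆ : ∀ (P Q : Fin n → Bool) → (P ─ Q) ⊆ P
  ─-⊆ P Q i = proj₁ ∘ T-∧ .to

  ⁅⁆-⊆ : ∀ (P : Fin n → Bool) {j} → T (P j) → ⁅ j ⁆ ⊆ P
  ⁅⁆-⊆ P Pj i i=j = subst (T ∘ P) (sym (∈⁅⁆⇒≡ i=j)) Pj

  Disjoint-─ : ∀ (P Q : Fin n → Bool) → Disjoint Q (P ─ Q)
  Disjoint-─ P Q i Qi P─Qi = T-not⁻ (T-∧ .to P─Qi .proj₂) Qi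

  ⊆─⇒Disjoint : ∀ {P Q R : Fin n → Bool} → P ⊆ (Q ─ R) → Disjoint P R
  ⊆─⇒Disjoint P⊆Q─R i Pi = T-not⁻ (T-∧ .to (P⊆Q─R i Pi) .proj₂)

  indicator : Bool → ℕ
  indicator b = if b then 1 else 0

  indicator-true : ∀ {a} → T a → indicator a ≡ 1
  indicator-true {true} _ = refl

  indicator-false : ∀ {a} → ¬ T a → indicator a ≡ 0
  indicator-false {true}  ¬a = ⊥-elim (¬a tt)
  indicator-false {false} _  = refl

  count : (Fin n → Bool) → ℕ
  count P = sum (indicator ∘ P)

  private
    sum-mono-≤ : ∀ {f g : Fin n → ℕ} → (∀ i → f i ≤ g i) → sum f ≤ sum g
    sum-mono-≤ {zero}  f≤g = z≤n
    sum-mono-≤ {suc n} f≤g = ℕ.+-mono-≤ (f≤g zero) (sum-mono-≤ (f≤g ∘ suc))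

  count-cong : ∀ {P Q : Fin n → Bool} → (∀ i → P i ≡ Q i) → count P ≡ count Q
  count-cong P≗Q = sum-cong-≗ (cong indicator ∘ P≗Q)

  count-mono : ∀ (P Q : Fin n → Bool) → P ⊆ Q → count P ≤ count Q
  count-mono P Q P⊆Q = sum-mono-≤ λ i → indicator-mono (P⊆Q i)
    where
      indicator-mono : ∀ {a b} → (T a → T b) → indicator a ≤ indicator b
      indicator-mono {false}          _   = z≤n
      indicator-mono {true}  {true}   _   = ℕ.≤-refl
      indicator-mono {true}  {false} a⇒b = ⊥-elim (a⇒b tt)

  count-≐ : ∀ (P Q : Fin n → Bool) → P ⊆ Q → Q ⊆ P → count P ≡ count Q
  count-≐ P Q P⊆Q Q⊆P = ℕ.≤-antisym (count-mono P Q P⊆Q) (count-mono Q P Q⊆P)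

  count-∅ : ∀ (P : Fin n → Bool) → (∀ i → ¬ T (P i)) → count P ≡ 0
  count-∅ P P=∅ = sum-zero λ i → indicator-false (P=∅ i)

  count-full : count (λ (_ : Fin n) → true) ≡ n
  count-full {zero}  = refl
  count-full {suc n} = cong suc (count-full {n})

  count≤n : (P : Fin n → Bool) → count P ≤ n
  count≤n {n} P = subst (count P ≤_) (count-full {n}) (count-mono P (λ _ → true) (λ _ _ → tt))

  count-⁅⁆ : (j : Fin n) → count ⁅ j ⁆ ≡ 1
  count-⁅⁆ j = trans (sum-single j λ i i≢j → indicator-false (i≢j ∘ ∈⁅⁆⇒≡)) (indicator-true (≡⇒∈⁅⁆ refl))

  count-∪ : ∀ (P Q : Fin n → Bool) → Disjoint P Q → count (P ∪ Q) ≡ count P + count Q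
  count-∪ P Q P∩Q=∅ =
    trans (sum-cong-≗ λ i → indicator-∨ (P∩Q=∅ i)) (∑-distrib-+ (indicator ∘ P) (indicator ∘ Q))
    where
      indicator-∨ : ∀ {a b} → (T a → ¬ T b) → indicator (a ∨ b) ≡ indicator a + indicator b
      indicator-∨ {true}  {true}  a⇒¬b = ⊥-elim (a⇒¬b tt tt)
      indicator-∨ {true}  {false} _    = refl
      indicator-∨ {false}         _    = refl

  count-∪-≤ : ∀ (P Q : Fin n → Bool) → count (P ∪ Q) ≤ count P + count Q
  count-∪-≤ P Q = ℕ.≤-trans (sum-mono-≤ λ i → indicator-∨ (P i) (Q i))
                            (ℕ.≤-reflexive (∑-distrib-+ (indicator ∘ P) (indicator ∘ Q)))
    where
      indicator-∨ : ∀ a b → indicator (a ∨ b) ≤ indicator a + indicator b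
      indicator-∨ true  _ = s≤s z≤n
      indicator-∨ false _ = ℕ.≤-refl

  count-∁ : ∀ (P : Fin n → Bool) → count P + count (∁ P) ≡ n
  count-∁ {n} P = begin
    count P + count (∁ P)          ≡⟨ count-∪ P (∁ P) (λ i Pi ¬Pi → T-not⁻ ¬Pi Pi) ⟨
    count (P ∪ ∁ P)                ≡⟨ count-cong (∨-inverseʳ ∘ P) ⟩
    count (λ (_ : Fin n) → true)   ≡⟨ count-full {n} ⟩
    n                              ∎
    where open ≡-Reasoning

  count-∩-─ : ∀ (P Q : Fin n → Bool) → count P ≡ count (P ∩ Q) + count (P ─ Q)
  count-∩-─ P Q = trans (count-cong split) (count-∪ (P ∩ Q) (P ─ Q) disjoint)
    where
      split : ∀ i → P i ≡ ((P ∩ Q) ∪ (P ─ Q)) i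
      split i with P i | Q i
      ... | true  | true  = refl
      ... | true  | false = refl
      ... | false | _     = refl
      disjoint : Disjoint (P ∩ Q) (P ─ Q)
      disjoint i P∩Qi P─Qi = T-not⁻ (T-∧ {P i} .to P─Qi .proj₂) (T-∧ {P i} .to P∩Qi .proj₂)

  count-─ : ∀ (P Q : Fin n → Bool) → Q ⊆ P → count P ≡ count Q + count (P ─ Q)
  count-─ P Q Q⊆P = trans (count-∩-─ P Q) (cong (_+ count (P ─ Q)) (count-≐ (P ∩ Q) Q P∩Q⊆Q Q⊆P∩Q))
    where
      P∩Q⊆Q : (P ∩ Q) ⊆ Q
      P∩Q⊆Q i = proj₂ ∘ T-∧ {P i} .to
      Q⊆P∩Q : Q ⊆ (P ∩ Q)
      Q⊆P∩Q i Qi = T-∧ .from (Q⊆P i Qi , Qi)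

  count-─⁅⁆ : ∀ (P : Fin n → Bool) {j} → T (P j) → count P ≡ suc (count (P ─ ⁅ j ⁆))
  count-─⁅⁆ P {j} Pj = trans (count-─ P ⁅ j ⁆ (⁅⁆-⊆ P Pj)) (cong (_+ count (P ─ ⁅ j ⁆)) (count-⁅⁆ j))

  count>0⇒∃ : ∀ (P : Fin n → Bool) → 0 < count P → ∃ λ i → T (P i)
  count>0⇒∃ P 0<|P| with any? (λ i → T? (P i))
  ... | yes witness = witness
  ... | no  none    = contradiction (count-∅ P λ i Pi → none (i , Pi)) (ℕ.>⇒≢ 0<|P|)

  count≤1 : ∀ (P : Fin n → Bool) → (∀ i j → T (P i) → T (P j) → i ≡ j) → count P ≤ 1
  count≤1 P unique with any? (λ i → T? (P i))
  ... | no  none     = ℕ.≤-trans (ℕ.≤-reflexive (count-∅ P λ i Pi → none (i , Pi))) z≤n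
  ... | yes (j , Pj) = subst (count P ≤_) (count-⁅⁆ j) (count-mono P ⁅ j ⁆ λ i Pi → ≡⇒∈⁅⁆ (unique i j Pi Pj))

module Hall where

  open import Data.Bool using (Bool; true; false; T; if_then_else_; _∧_)
  open import Data.Bool.Properties using (T-∧; T-∨; T-≡)
  open import Data.Empty using (⊥-elim)
  open import Data.Fin using (Fin)
  open import Data.Fin.Properties using (any?; all?)
  open import Data.Fin.Subset using (Subset)
  open import Data.Fin.Subset.Properties using (anySubset?)
  open import Data.Nat using (ℕ; zero; suc; _+_; _≤_; _<_; z≤n; s≤s)
  open import Data.Nat.Induction using (<-wellFounded)
  import Data.Nat.Properties as ℕ
  open import Data.Nat.Tactic.RingSolver using (solve-∀)
  open import Data.Product using (Σ-syntax; ∃; _×_; _,_; proj₁; proj₂)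
  open import Data.Sum using (_⊎_; inj₁; inj₂; [_,_]′)
  open import Data.Vec using (lookup; tabulate)
  open import Data.Vec.Properties using (lookup∘tabulate)
  open import Function using (_∘_; case_of_)
  open import Function.Bundles using (module Equivalence)
  open import Induction.WellFounded using (Acc; acc)
  open import Relation.Binary.PropositionalEquality using (_≡_; refl; sym; trans; cong; subst; subst₂)
  open import Relation.Nullary using (¬_; Dec; yes; no; contradiction)
  open import Relation.Nullary.Decidable using (⌊_⌋; T?; toWitness; fromWitness; _×-dec_; _→-dec_)

  open Counting
  open Equivalence using (to; from)

  module _ {n : ℕ} (R : Fin n → Fin n → Bool) where

    nbhd : (B X : Fin n → Bool) → Fin n → Bool
    nbhd B X v = B v ∧ ⌊ any? (λ a → T? (X a ∧ R a v)) ⌋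

    ∈nbhd⁺ : ∀ {B X a v} → T (B v) → T (X a) → T (R a v) → T (nbhd B X v)
    ∈nbhd⁺ {B} {X} {a} {v} Bv Xa Rav =
      T-∧ .from (Bv , fromWitness {a? = any? (λ a → T? (X a ∧ R a v))} (a , T-∧ .from (Xa , Rav)))

    ∈nbhd⁻ : ∀ {B X v} → T (nbhd B X v) → T (B v) × ∃ λ a → T (X a) × T (R a v)
    ∈nbhd⁻ {B} {X} {v} h with T-∧ .to h
    ... | Bv , any with toWitness {a? = any? (λ a → T? (X a ∧ R a v))} any
    ... | a , XaRav = Bv , a , T-∧ .to XaRav

    nbhd-mono : ∀ {B X Y} → X ⊆ Y → nbhd B X ⊆ nbhd B Y
    nbhd-mono {B} {X} {Y} X⊆Y v h with ∈nbhd⁻ {B} {X} h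
    ... | Bv , a , Xa , Rav = ∈nbhd⁺ {B} {Y} Bv (X⊆Y a Xa) Rav

    nbhd-⊆ : ∀ B X → nbhd B X ⊆ B
    nbhd-⊆ B X v = proj₁ ∘ T-∧ .to

    nbhd-∅ : ∀ B → count (nbhd B (λ _ → false)) ≡ 0
    nbhd-∅ B = count-∅ (nbhd B (λ _ → false)) λ v h → case ∈nbhd⁻ {B} {λ _ → false} h of λ ()

    nbhd-∪⁻ : ∀ {B} X Y v → T (nbhd B (X ∪ Y) v) → T (nbhd B X v) ⊎ T (nbhd B Y v)
    nbhd-∪⁻ {B} X Y v h with ∈nbhd⁻ {B} {X ∪ Y} h
    ... | Bv , a , XYa , Rav =
      Data.Sum.map (λ Xa → ∈nbhd⁺ {B} {X} Bv Xa Rav) (λ Ya → ∈nbhd⁺ {B} {Y} Bv Ya Rav) (T-∨ .to XYa)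

    nbhd-─ : ∀ {B} C X → nbhd B X ⊆ (nbhd (B ─ C) X ∪ C)
    nbhd-─ {B} C X v h with ∈nbhd⁻ {B} {X} h | T? (C v)
    ... | _               | yes Cv  = T-∨ .from (inj₂ Cv)
    ... | Bv , a , Xa , Rav | no  ¬Cv = T-∨ .from (inj₁ (∈nbhd⁺ {B ─ C} {X} (T-∧ .from (Bv , T-not⁺ ¬Cv)) Xa Rav))

    nbhd-∪ : ∀ {B} X Y → nbhd B (Y ∪ X) ⊆ (nbhd (B ─ nbhd B X) Y ∪ nbhd B X)
    nbhd-∪ {B} X Y v h with T? (nbhd B X v) | ∈nbhd⁻ {B} {Y ∪ X} h
    ... | yes v∈NX | _                  = T-∨ .from (inj₂ v∈NX)
    ... | no  v∉NX | Bv , a , YXa , Rav with T-∨ .to YXa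
    ...   | inj₁ Ya = T-∨ .from (inj₁ (∈nbhd⁺ {B ─ nbhd B X} {Y} (T-∧ .from (Bv , T-not⁺ v∉NX)) Ya Rav))
    ...   | inj₂ Xa = ⊥-elim (v∉NX (∈nbhd⁺ {B} {X} Bv Xa Rav))

    nbhd-isolated : ∀ {B a} → (∀ b → T (B b) → ¬ T (R a b)) → ∀ X → nbhd B (X ∪ ⁅ a ⁆) ⊆ nbhd B X
    nbhd-isolated {B} {a} a-isolated X v h with nbhd-∪⁻ {B} X ⁅ a ⁆ v h
    ... | inj₁ v∈NX = v∈NX
    ... | inj₂ v∈Na with ∈nbhd⁻ {B} {⁅ a ⁆} v∈Na
    ...   | Bv , a′ , a′=a , Ra′v = ⊥-elim (a-isolated v Bv (subst (λ c → T (R c v)) (∈⁅⁆⇒≡ a′=a) Ra′v))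

    HallCondition : ℕ → (A B : Fin n → Bool) → Set
    HallCondition d A B = ∀ X → X ⊆ A → count X ≤ count (nbhd B X) + d

    HallCondition-mono : ∀ {d A A′ B} → A′ ⊆ A → HallCondition d A B → HallCondition d A′ B
    HallCondition-mono A′⊆A hc X X⊆A′ = hc X (λ i → A′⊆A i ∘ X⊆A′ i)

    record Matching (A B : Fin n → Bool) : Set where
      field
        domain    : Fin n → Bool
        partner   : Fin n → Fin n
        domain⊆A  : domain ⊆ A
        partner∈B : ∀ i → T (domain i) → T (B (partner i))
        related   : ∀ i → T (domain i) → T (R i (partner i))
        injective : ∀ i j → T (domain i) → T (domain j) → partner i ≡ partner j → i ≡ j

      size : ℕ
      size = count domain

    open Matching

    DeficientMatching : ℕ → (A B : Fin n → Bool) → Set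
    DeficientMatching d A B = Σ[ m ∈ Matching A B ] count A ≤ size m + d

    emptyMatching : ∀ {A B} → Matching A B
    emptyMatching = record
      { domain = λ _ → false ; partner = λ i → i
      ; domain⊆A = λ _ () ; partner∈B = λ _ () ; related = λ _ () ; injective = λ _ _ () }

    singletonMatching : ∀ {A B a b} → T (A a) → T (B b) → T (R a b) → Matching A B
    singletonMatching {A} {B} {a} {b} Aa Bb Rab = record
      { domain    = ⁅ a ⁆
      ; partner   = λ _ → b
      ; domain⊆A  = λ i i=a → subst (T ∘ A) (sym (∈⁅⁆⇒≡ i=a)) Aa
      ; partner∈B = λ _ _ → Bb
      ; related   = λ i i=a → subst (λ j → T (R j b)) (sym (∈⁅⁆⇒≡ i=a)) Rab
      ; injective = λ i j i=a j=a _ → trans (∈⁅⁆⇒≡ i=a) (sym (∈⁅⁆⇒≡ j=a))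
      }

    Matching-mono : ∀ {A A′ B B′} → A ⊆ A′ → B ⊆ B′ → Matching A B → Matching A′ B′
    Matching-mono A⊆A′ B⊆B′ m = record
      { domain    = domain m
      ; partner   = partner m
      ; domain⊆A  = λ i → A⊆A′ i ∘ domain⊆A m i
      ; partner∈B = λ i → B⊆B′ _ ∘ partner∈B m i
      ; related   = related m
      ; injective = injective m
      }

    Matching-nbhd : ∀ {A B} → Matching A B → Matching A (nbhd B A)
    Matching-nbhd {A} {B} m = record
      { domain    = domain m
      ; partner   = partner m
      ; domain⊆A  = domain⊆A m
      ; partner∈B = λ i i∈M → ∈nbhd⁺ {B} {A} (partner∈B m i i∈M) (domain⊆A m i i∈M) (related m i i∈M)
      ; related   = related m
      ; injective = injective m
      }

    module _ {A₁ B₁ A₂ B₂ : Fin n → Bool} (A₁∩A₂=∅ : Disjoint A₁ A₂) (B₁∩B₂=∅ : Disjoint B₁ B₂)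
             (m₁ : Matching A₁ B₁) (m₂ : Matching A₂ B₂) where

      private
        module M₁ = Matching m₁
        module M₂ = Matching m₂

        partner₁₂ : Fin n → Fin n
        partner₁₂ i = if M₁.domain i then M₁.partner i else M₂.partner i

        partner₁₂-₁ : ∀ {i} → T (M₁.domain i) → partner₁₂ i ≡ M₁.partner i
        partner₁₂-₁ {i} i∈M₁ rewrite T-≡ .to i∈M₁ = refl

        partner₁₂-₂ : ∀ {i} → T (M₂.domain i) → partner₁₂ i ≡ M₂.partner i
        partner₁₂-₂ {i} i∈M₂ with M₁.domain i in i∈M₁
        ... | true  = ⊥-elim (A₁∩A₂=∅ i (M₁.domain⊆A i (T-≡ .from i∈M₁)) (M₂.domain⊆A i i∈M₂))
        ... | false = refl

        partner₁₂∈B₁₂ : ∀ i → T (M₁.domain i) ⊎ T (M₂.domain i) → T ((B₁ ∪ B₂) (partner₁₂ i))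
        partner₁₂∈B₁₂ i (inj₁ i∈M₁) = T-∨ .from (inj₁ (subst (T ∘ B₁) (sym (partner₁₂-₁ i∈M₁)) (M₁.partner∈B i i∈M₁)))
        partner₁₂∈B₁₂ i (inj₂ i∈M₂) = T-∨ .from (inj₂ (subst (T ∘ B₂) (sym (partner₁₂-₂ i∈M₂)) (M₂.partner∈B i i∈M₂)))

        related₁₂ : ∀ i → T (M₁.domain i) ⊎ T (M₂.domain i) → T (R i (partner₁₂ i))
        related₁₂ i (inj₁ i∈M₁) = subst (T ∘ R i) (sym (partner₁₂-₁ i∈M₁)) (M₁.related i i∈M₁)
        related₁₂ i (inj₂ i∈M₂) = subst (T ∘ R i) (sym (partner₁₂-₂ i∈M₂)) (M₂.related i i∈M₂)

        injective₁₂ : ∀ i j → T (M₁.domain i) ⊎ T (M₂.domain i) → T (M₁.domain j) ⊎ T (M₂.domain j) →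
                      partner₁₂ i ≡ partner₁₂ j → i ≡ j
        injective₁₂ i j (inj₁ i∈M₁) (inj₁ j∈M₁) eq =
          M₁.injective i j i∈M₁ j∈M₁ (trans (sym (partner₁₂-₁ i∈M₁)) (trans eq (partner₁₂-₁ j∈M₁)))
        injective₁₂ i j (inj₂ i∈M₂) (inj₂ j∈M₂) eq =
          M₂.injective i j i∈M₂ j∈M₂ (trans (sym (partner₁₂-₂ i∈M₂)) (trans eq (partner₁₂-₂ j∈M₂)))
        injective₁₂ i j (inj₁ i∈M₁) (inj₂ j∈M₂) eq = ⊥-elim (B₁∩B₂=∅ _ (M₁.partner∈B i i∈M₁)
          (subst (T ∘ B₂) (trans (sym (partner₁₂-₂ j∈M₂)) (trans (sym eq) (partner₁₂-₁ i∈M₁))) (M₂.partner∈B j j∈M₂)))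
        injective₁₂ i j (inj₂ i∈M₂) (inj₁ j∈M₁) eq = ⊥-elim (B₁∩B₂=∅ _ (M₁.partner∈B j j∈M₁)
          (subst (T ∘ B₂) (trans (sym (partner₁₂-₂ i∈M₂)) (trans eq (partner₁₂-₁ j∈M₁))) (M₂.partner∈B i i∈M₂)))

      union : Matching (A₁ ∪ A₂) (B₁ ∪ B₂)
      union = record
        { domain    = M₁.domain ∪ M₂.domain
        ; partner   = partner₁₂
        ; domain⊆A  = λ i → T-∨ .from ∘ Data.Sum.map (M₁.domain⊆A i) (M₂.domain⊆A i) ∘ T-∨ .to
        ; partner∈B = λ i → partner₁₂∈B₁₂ i ∘ T-∨ .to
        ; related   = λ i → related₁₂ i ∘ T-∨ .to
        ; injective = λ i j i∈M j∈M → injective₁₂ i j (T-∨ .to i∈M) (T-∨ .to j∈M)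
        }

      size-union : size union ≡ size m₁ + size m₂
      size-union = count-∪ M₁.domain M₂.domain λ i i∈M₁ i∈M₂ →
        A₁∩A₂=∅ i (M₁.domain⊆A i i∈M₁) (M₂.domain⊆A i i∈M₂)

    Critical : ℕ → (A B X : Fin n → Bool) → Set
    Critical d A B X = X ⊆ A × 0 < count X × count X < count A × count (nbhd B X) + d ≤ count X

    Critical-cong : ∀ {d A B X Y} → (∀ i → X i ≡ Y i) → Critical d A B X → Critical d A B Y
    Critical-cong {d} {A} {B} {X} {Y} X≗Y (X⊆A , 0<X , X<A , NX+d≤X) =
      ⊆-trans Y⊆X X⊆A , subst (0 <_) |X|=|Y| 0<X , subst (_< count A) |X|=|Y| X<A ,
      subst₂ _≤_ (cong (_+ d) (count-≐ _ _ (nbhd-mono X⊆Y) (nbhd-mono Y⊆X))) |X|=|Y| NX+d≤X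
      where
        X⊆Y : X ⊆ Y
        X⊆Y i = subst T (X≗Y i)
        Y⊆X : Y ⊆ X
        Y⊆X i = subst T (sym (X≗Y i))
        |X|=|Y| : count X ≡ count Y
        |X|=|Y| = count-cong X≗Y

    critical? : ∀ d A B (S : Subset n) → Dec (Critical d A B (lookup S))
    critical? d A B S =
      all? (λ i → T? (X i) →-dec T? (A i)) ×-dec 0 ℕ.<? count X ×-dec
      count X ℕ.<? count A ×-dec count (nbhd B X) + d ℕ.≤? count X
      where
        X : Fin n → Bool
        X = lookup S

    HallBelow : ℕ → Set
    HallBelow m = ∀ {d A B} → count A < m → HallCondition d A B → DeficientMatching d A B

    module _ {A B : Fin n → Bool} (rec : HallBelow (count A)) where

      hall-isolated : ∀ {d a} → HallCondition d A B → T (A a) → (∀ b → T (B b) → ¬ T (R a b)) →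
                      DeficientMatching d A B
      hall-isolated {zero} {a} hc Aa a-isolated = contradiction (begin
          1                         ≡⟨ sym (count-⁅⁆ a) ⟩
          count ⁅ a ⁆                ≤⟨ hc ⁅ a ⁆ (⁅⁆-⊆ A Aa) ⟩
          count (nbhd B ⁅ a ⁆) + 0   ≡⟨ ℕ.+-identityʳ _ ⟩
          count (nbhd B ⁅ a ⁆)       ≤⟨ count-mono (nbhd B ⁅ a ⁆) _ (nbhd-isolated a-isolated (λ _ → false)) ⟩
          count (nbhd B (λ _ → false)) ≡⟨ nbhd-∅ B ⟩
          0                         ∎) λ ()
        where open ℕ.≤-Reasoning
      hall-isolated {suc d} {a} hc Aa a-isolated = extend (rec A─a<A hc′)
        where
          open ℕ.≤-Reasoning
          A─a<A : count (A ─ ⁅ a ⁆) < count A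
          A─a<A = ℕ.≤-reflexive (sym (count-─⁅⁆ A Aa))

          hc′ : HallCondition d (A ─ ⁅ a ⁆) B
          hc′ X X⊆A─a = ℕ.≤-pred (begin
            suc (count X)
              ≡⟨ ℕ.+-comm 1 (count X) ⟩
            count X + 1
              ≡⟨ cong (count X +_) (count-⁅⁆ a) ⟨
            count X + count ⁅ a ⁆
              ≡⟨ count-∪ X ⁅ a ⁆ (⊆─⇒Disjoint X⊆A─a) ⟨
            count (X ∪ ⁅ a ⁆)
              ≤⟨ hc (X ∪ ⁅ a ⁆) (∪-least (⊆-trans X⊆A─a (─-⊆ A ⁅ a ⁆)) (⁅⁆-⊆ A Aa)) ⟩
            count (nbhd B (X ∪ ⁅ a ⁆)) + suc d
              ≤⟨ ℕ.+-monoˡ-≤ (suc d) (count-mono _ _ (nbhd-isolated a-isolated X)) ⟩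
            count (nbhd B X) + suc d
              ≡⟨ ℕ.+-suc _ d ⟩
            suc (count (nbhd B X) + d) ∎)

          extend : DeficientMatching d (A ─ ⁅ a ⁆) B → DeficientMatching (suc d) A B
          extend (m , A─a≤m+d) = Matching-mono (─-⊆ A ⁅ a ⁆) (λ _ Bv → Bv) m , (begin
            count A                  ≡⟨ count-─⁅⁆ A Aa ⟩
            suc (count (A ─ ⁅ a ⁆))   ≤⟨ s≤s A─a≤m+d ⟩
            suc (size m + d)         ≡⟨ ℕ.+-suc (size m) d ⟨
            size m + suc d           ∎)

      hall-critical : ∀ {d X} → HallCondition d A B → Critical d A B X → DeficientMatching d A B
      hall-critical {d} {X} hc (X⊆A , 0<X , X<A , NX+d≤X) = combine (rec X<A hc₁) (rec A─X<A hc₂)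
        where
          open ℕ.≤-Reasoning
          NX : Fin n → Bool
          NX = nbhd B X

          A─X<A : count (A ─ X) < count A
          A─X<A = ℕ.<-≤-trans (ℕ.m<n+m (count (A ─ X)) 0<X) (ℕ.≤-reflexive (sym (count-─ A X X⊆A)))

          hc₁ : HallCondition d X B
          hc₁ = HallCondition-mono X⊆A hc

          hc₂ : HallCondition 0 (A ─ X) (B ─ NX)
          hc₂ Y Y⊆A─X = ℕ.+-cancelʳ-≤ (count X) _ _ (begin
            count Y + count X                          ≡⟨ count-∪ Y X (⊆─⇒Disjoint Y⊆A─X) ⟨
            count (Y ∪ X)                              ≤⟨ hc (Y ∪ X) (∪-least (⊆-trans Y⊆A─X (─-⊆ A X)) X⊆A) ⟩
            count (nbhd B (Y ∪ X)) + d                  ≤⟨ ℕ.+-monoˡ-≤ d (count-mono _ _ (nbhd-∪ X Y)) ⟩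
            count (nbhd (B ─ NX) Y ∪ NX) + d            ≤⟨ ℕ.+-monoˡ-≤ d (count-∪-≤ (nbhd (B ─ NX) Y) NX) ⟩
            count (nbhd (B ─ NX) Y) + count NX + d      ≡⟨ ℕ.+-assoc (count (nbhd (B ─ NX) Y)) (count NX) d ⟩
            count (nbhd (B ─ NX) Y) + (count NX + d)    ≤⟨ ℕ.+-monoʳ-≤ (count (nbhd (B ─ NX) Y)) NX+d≤X ⟩
            count (nbhd (B ─ NX) Y) + count X           ≡⟨ cong (_+ count X) (ℕ.+-identityʳ _) ⟨
            count (nbhd (B ─ NX) Y) + 0 + count X       ∎)

          combine : DeficientMatching d X B → DeficientMatching 0 (A ─ X) (B ─ NX) → DeficientMatching d A B
          combine (m₁ , X≤m₁+d) (m₂ , A─X≤m₂) =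
            Matching-mono (∪-least X⊆A (─-⊆ A X)) (∪-least (nbhd-⊆ B X) (─-⊆ B NX)) m , (begin
              count A
                ≡⟨ count-─ A X X⊆A ⟩
              count X + count (A ─ X)
                ≤⟨ ℕ.+-mono-≤ X≤m₁+d A─X≤m₂ ⟩
              size m₁ + d + (size m₂ + 0)
                ≡⟨ rearrange (size m₁) (size m₂) d ⟩
              size m₁ + size m₂ + d
                ≡⟨ cong (_+ d) (size-union (Disjoint-─ A X) (Disjoint-─ B NX) (Matching-nbhd m₁) m₂) ⟨
              size m + d ∎)
            where
              m : Matching (X ∪ (A ─ X)) (nbhd B X ∪ (B ─ NX))
              m = union (Disjoint-─ A X) (Disjoint-─ B NX) (Matching-nbhd m₁) m₂
              rearrange : ∀ a b d → a + d + (b + 0) ≡ a + b + d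
              rearrange = solve-∀

      hall-extend : ∀ {d a b} → HallCondition d A B → (∀ X → ¬ Critical d A B X) →
                    T (A a) → T (B b) → T (R a b) → DeficientMatching d A B
      hall-extend {d} {a} {b} hc no-critical Aa Bb Rab = extend (rec A─a<A hc′)
        where
          open ℕ.≤-Reasoning
          A─a<A : count (A ─ ⁅ a ⁆) < count A
          A─a<A = ℕ.≤-reflexive (sym (count-─⁅⁆ A Aa))

          hc′ : HallCondition d (A ─ ⁅ a ⁆) (B ─ ⁅ b ⁆)
          hc′ X X⊆A─a with 0 ℕ.<? count X
          ... | no  X≯0 = ℕ.≤-trans (ℕ.≮⇒≥ X≯0) z≤n
          ... | yes 0<X = ℕ.≤-pred (begin
            suc (count X)
              ≤⟨ ℕ.≰⇒> (λ tight → no-critical X (X⊆A , 0<X , X<A , tight)) ⟩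
            count (nbhd B X) + d
              ≤⟨ ℕ.+-monoˡ-≤ d (count-mono _ _ (nbhd-─ ⁅ b ⁆ X)) ⟩
            count (nbhd (B ─ ⁅ b ⁆) X ∪ ⁅ b ⁆) + d
              ≤⟨ ℕ.+-monoˡ-≤ d (count-∪-≤ (nbhd (B ─ ⁅ b ⁆) X) ⁅ b ⁆) ⟩
            count (nbhd (B ─ ⁅ b ⁆) X) + count ⁅ b ⁆ + d
              ≡⟨ cong (λ c → count (nbhd (B ─ ⁅ b ⁆) X) + c + d) (count-⁅⁆ b) ⟩
            count (nbhd (B ─ ⁅ b ⁆) X) + 1 + d
              ≡⟨ rearrange (count (nbhd (B ─ ⁅ b ⁆) X)) d ⟩
            suc (count (nbhd (B ─ ⁅ b ⁆) X) + d) ∎)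
            where
              X⊆A : X ⊆ A
              X⊆A = ⊆-trans X⊆A─a (─-⊆ A ⁅ a ⁆)
              X<A : count X < count A
              X<A = ℕ.≤-<-trans (count-mono X (A ─ ⁅ a ⁆) X⊆A─a) A─a<A
              rearrange : ∀ c d → c + 1 + d ≡ suc (c + d)
              rearrange = solve-∀

          extend : DeficientMatching d (A ─ ⁅ a ⁆) (B ─ ⁅ b ⁆) → DeficientMatching d A B
          extend (m′ , A─a≤m′+d) =
            Matching-mono (∪-least (⁅⁆-⊆ A Aa) (─-⊆ A ⁅ a ⁆)) (∪-least (⁅⁆-⊆ B Bb) (─-⊆ B ⁅ b ⁆)) m , (begin
              count A
                ≡⟨ count-─⁅⁆ A Aa ⟩
              suc (count (A ─ ⁅ a ⁆))
                ≤⟨ s≤s A─a≤m′+d ⟩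
              suc (size m′ + d)
                ≡⟨ cong (λ c → c + size m′ + d) (count-⁅⁆ a) ⟨
              count ⁅ a ⁆ + size m′ + d
                ≡⟨ cong (_+ d) (size-union (Disjoint-─ A ⁅ a ⁆) (Disjoint-─ B ⁅ b ⁆) a↦b m′) ⟨
              size m + d ∎)
            where
              a↦b : Matching ⁅ a ⁆ ⁅ b ⁆
              a↦b = singletonMatching (≡⇒∈⁅⁆ refl) (≡⇒∈⁅⁆ refl) Rab
              m : Matching (⁅ a ⁆ ∪ (A ─ ⁅ a ⁆)) (⁅ b ⁆ ∪ (B ─ ⁅ b ⁆))
              m = union (Disjoint-─ A ⁅ a ⁆) (Disjoint-─ B ⁅ b ⁆) a↦b m′

    -- A vertex of A without neighbours in B uses up one unit of deficiency; a
    -- critical set X splits the problem into X and A ∖ X, the latter with deficiency 0 against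
    -- B ∖ N(X); without critical sets, any edge ab extends a matching of A ∖ {a} into B ∖ {b}.
    hall-step : ∀ {d A B} → HallBelow (count A) → HallCondition d A B → DeficientMatching d A B
    hall-step {d} {A} {B} rec hc with any? (T? ∘ A)
    ... | no A=∅ = emptyMatching , ℕ.≤-trans (ℕ.≤-reflexive (count-∅ A λ a Aa → A=∅ (a , Aa))) z≤n
    ... | yes (a , Aa) with any? (λ b → T? (B b ∧ R a b))
    ...   | no isolated = hall-isolated rec hc Aa (λ b Bb Rab → isolated (b , T-∧ .from (Bb , Rab)))
    ...   | yes (b , BbRab) with anySubset? (critical? d A B)
    ...     | yes (S , critical) = hall-critical rec hc critical
    ...     | no  none = hall-extend rec hc no-critical Aa (T-∧ .to BbRab .proj₁) (T-∧ .to BbRab .proj₂)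
      where
        no-critical : ∀ X → ¬ Critical d A B X
        no-critical X = none ∘ (tabulate X ,_) ∘ Critical-cong (sym ∘ lookup∘tabulate X)

    hall-acc : ∀ {d A B} → Acc _<_ (count A) → HallCondition d A B → DeficientMatching d A B
    hall-acc (acc rs) = hall-step (λ lt → hall-acc (rs lt))

    hall : ∀ {d A B} → HallCondition d A B → DeficientMatching d A B
    hall {A = A} = hall-acc (<-wellFounded (count A))

module Connectivity where

  open import Data.Bool using (Bool; true; false; T; _∧_)
  open import Data.Bool.Properties using (T-∧; T-∨; T-≡)
  open import Data.Empty using (⊥-elim)
  open import Data.Fin using (Fin; zero; suc; _≟_)
  open import Data.Fin.Properties using (any?)
  open import Data.Fin.Subset using (Subset; _∈_; _∉_; ∣_∣)
  open import Data.Fin.Subset.Properties using (p⊂q⇒∣p∣<∣q∣; ⊆⊤; ∈⊤; ∣⊤∣≡n)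
  open import Data.List using (foldr)
  open import Data.List.Membership.Propositional using (lose)
  open import Data.List.Membership.Propositional.Properties using (∈-allFin)
  open import Data.List.Properties using (map-tabulate)
  open import Data.List.Relation.Unary.Any.Properties using (any⁺)
  open import Data.Nat using (ℕ; zero; suc; _+_; _*_; _∸_; _≤_; _<_; z≤n; s≤s)
  import Data.Nat.Properties as ℕ
  open import Data.Nat.Tactic.RingSolver using (solve-∀)
  open import Data.Product using (∃; _×_; _,_; proj₁; proj₂)
  open import Data.Sum using (inj₁; inj₂)
  open import Data.Unit using (tt)
  open import Data.Vec using (tabulate)
  open import Data.Vec.Properties using (lookup∘tabulate; []=⇒lookup; lookup⇒[]=)
  open import Function using (_∘_)
  open import Function.Bundles using (module Equivalence)
  open import Relation.Binary.PropositionalEquality using (_≡_; _≢_; refl; sym; trans; cong; cong₂; subst; subst₂; module ≡-Reasoning)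
  open import Relation.Nullary using (¬_; Dec; yes; no; contradiction; ¬?)
  open import Relation.Nullary.Decidable using (T?; _×-dec_; dec-true; decidable-stable)

  open import Defs
  open FiniteSums using (foldr-tabulate)
  open Counting
  open Equivalence using (to; from)

  private
    variable
      n : ℕ

  ∣tabulate∣ : (P : Fin n → Bool) → ∣ tabulate P ∣ ≡ count P
  ∣tabulate∣ {zero}  P = refl
  ∣tabulate∣ {suc n} P with P zero
  ... | true  = cong suc (∣tabulate∣ (P ∘ suc))
  ... | false = ∣tabulate∣ (P ∘ suc)

  ∈-tabulate⁺ : ∀ (P : Fin n → Bool) {i} → T (P i) → i ∈ tabulate P
  ∈-tabulate⁺ P {i} Pi = lookup⇒[]= i (tabulate P) (trans (lookup∘tabulate P i) (T-≡ .to Pi))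

  ∈-tabulate⁻ : ∀ (P : Fin n → Bool) {i} → i ∈ tabulate P → T (P i)
  ∈-tabulate⁻ P {i} i∈P = T-≡ .from (trans (sym (lookup∘tabulate P i)) ([]=⇒lookup i∈P))

  ∉⇒∣∣<n : ∀ {S : Subset n} {i} → i ∉ S → ∣ S ∣ < n
  ∉⇒∣∣<n {n} {S} i∉S = subst (∣ S ∣ <_) (∣⊤∣≡n n) (p⊂q⇒∣p∣<∣q∣ (⊆⊤ , _ , ∈⊤ , i∉S))

  n∸1<n : Fin n → n ∸ 1 < n
  n∸1<n {suc n} _ = ℕ.n<1+n n

  module _ {n : ℕ} (G : Graph n) where

    private
      A : Fin n → Fin n → Bool
      A = adj G

    deg≡count : ∀ v → deg G v ≡ count (A v)
    deg≡count v = trans (cong (foldr _+_ 0) (map-tabulate (λ i → i) (indicator ∘ A v)))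
                        (foldr-tabulate _+_ 0 (indicator ∘ A v))

    adj⇒1≤deg : ∀ {u v} → T (A u v) → 1 ≤ deg G u
    adj⇒1≤deg {u} {v} uv = subst₂ _≤_ (count-⁅⁆ v) (sym (deg≡count u)) (count-mono ⁅ v ⁆ (A u) (⁅⁆-⊆ (A u) uv))

    N[_] : Fin n → Fin n → Bool
    N[ v ] = A v ∪ ⁅ v ⁆

    count-N[] : ∀ v → count N[ v ] ≡ suc (deg G v)
    count-N[] v = begin
      count N[ v ]
        ≡⟨ count-∪ (A v) ⁅ v ⁆ (λ i vi i=v → subst T (irrefl G v) (subst (T ∘ A v) (∈⁅⁆⇒≡ i=v) vi)) ⟩
      count (A v) + count ⁅ v ⁆
        ≡⟨ cong₂ _+_ (sym (deg≡count v)) (count-⁅⁆ v) ⟩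
      deg G v + 1
        ≡⟨ ℕ.+-comm (deg G v) 1 ⟩
      suc (deg G v) ∎
      where open ≡-Reasoning

    reach-refl : ∀ v → T (reach G 0 v v)
    reach-refl v = T-≡ .from (dec-true (v ≟ v) refl)

    reach-step : ∀ {m u w v} → T (A u w) → T (reach G m w v) → T (reach G (suc m) u v)
    reach-step {m} {u} {w} {v} uw w⇝v =
      T-∨ .from (inj₂ (any⁺ (λ w → A u w ∧ reach G m w v) (lose (∈-allFin w) (T-∧ .from (uw , w⇝v)))))

    distFrom-≥ : ∀ m f {u v} → m ≤ distFrom G m f u v
    distFrom-≥ m zero    = ℕ.≤-refl
    distFrom-≥ m (suc f) {u} {v} with reach G m u v
    ... | true  = ℕ.≤-refl
    ... | false = ℕ.≤-trans (ℕ.n≤1+n m) (distFrom-≥ (suc m) f)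

    distFrom-≤ : ∀ m f {u v j} → m ≤ j → T (reach G j u v) → distFrom G m f u v ≤ j
    distFrom-≤ m zero    m≤j _ = m≤j
    distFrom-≤ m (suc f) {u} {v} {j} m≤j u⇝v with reach G m u v in reached
    ... | true  = m≤j
    ... | false = distFrom-≤ (suc m) f (ℕ.≤∧≢⇒< m≤j m≢j) u⇝v
      where
        m≢j : m ≢ j
        m≢j refl = subst T reached u⇝v

    dist-≤ : ∀ {u v} j → T (reach G j u v) → dist G u v ≤ j
    dist-≤ j = distFrom-≤ 0 n z≤n

    dist-refl : ∀ v → dist G v v ≡ 0
    dist-refl v = ℕ.n≤0⇒n≡0 (dist-≤ 0 (reach-refl v))

    dist-adj : ∀ {u v} → T (A u v) → dist G u v ≡ 1
    dist-adj {u} {v} uv = ℕ.≤-antisym (dist-≤ 1 (reach-step {0} uv (reach-refl v))) (1≤distFrom n (ℕ.≤-<-trans z≤n (n∸1<n u)))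
      where
        1≤distFrom : ∀ f → 0 < f → 1 ≤ distFrom G 0 f u v
        1≤distFrom (suc f) _ with u ≟ v
        ... | yes u=v = ⊥-elim (subst T (irrefl G u) (subst (T ∘ A u) (sym u=v) uv))
        ... | no  _   = distFrom-≥ 1 f

    isComplete? : Dec (IsComplete G)
    isComplete? with any? (λ u → any? (λ v → ¬? (u ≟ v) ×-dec ¬? (T? (A u v))))
    ... | yes (u , v , u≢v , ¬uv) = no (λ complete → ¬uv (complete u v u≢v))
    ... | no  none = yes (λ u v u≢v → decidable-stable (T? (A u v)) (λ ¬uv → none (u , v , u≢v , ¬uv)))

    path-start : ∀ {S u v} → PathAvoid G S u v → u ∉ S
    path-start (here u∉S)     = u∉S
    path-start (step u∉S _ _) = u∉S

    connectivity<n : ∀ {k} → IsConnectivity G k → Fin n → k < n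
    connectivity<n (complete⇒ , incomplete⇒) v with isComplete?
    ... | yes complete   = subst (_< n) (sym (complete⇒ complete)) (n∸1<n v)
    ... | no  incomplete with incomplete⇒ incomplete
    ...   | (S , (u , _ , u∉S , _) , ∣S∣≡k) , _ = subst (_< n) ∣S∣≡k (∉⇒∣∣<n u∉S)

    connectivity≤deg : ∀ {k} → IsConnectivity G k → ∀ v → k ≤ deg G v
    connectivity≤deg {k} ic v with any? (λ u → ¬? (u ≟ v) ×-dec ¬? (T? (A v u)))
    ... | yes (u , u≢v , ¬vu) =
      subst (k ≤_) (trans (∣tabulate∣ (A v)) (sym (deg≡count v))) (ic .proj₂ incomplete .proj₂ (tabulate (A v)) separates)
      where
        incomplete : ¬ IsComplete G
        incomplete complete = ¬vu (complete v u (u≢v ∘ sym))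
        no-path : ¬ PathAvoid G (tabulate (A v)) v u
        no-path (here _)        = u≢v refl
        no-path (step _ vw w⇝u) = path-start w⇝u (∈-tabulate⁺ (A v) vw)
        separates : Disconnects G (tabulate (A v))
        separates = v , u , (λ v∈N → subst T (irrefl G v) (∈-tabulate⁻ (A v) v∈N)) , (¬vu ∘ ∈-tabulate⁻ (A v)) , no-path
    ... | no  none = ℕ.≤-pred (begin-strict
      k                           <⟨ connectivity<n ic v ⟩
      n                           ≡⟨ count-full {n} ⟨
      count (λ (_ : Fin n) → true) ≤⟨ count-mono (λ _ → true) N[ v ] (λ u _ → everything u) ⟩
      count N[ v ]                ≡⟨ count-N[] v ⟩
      suc (deg G v)               ∎)
      where
        open ℕ.≤-Reasoning
        everything : ∀ u → T (N[ v ] u)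
        everything u with u ≟ v
        ... | yes _   = T-∨ {A v u} .from (inj₂ tt)
        ... | no  u≢v = T-∨ .from (inj₁ (decidable-stable (T? (A v u)) (λ ¬vu → none (u , u≢v , ¬vu))))

    cut-bound : ∀ {k} → IsConnectivity G k → (K X : Fin n → Bool) {a b : Fin n} →
                X ⊆ K → T (X a) → T (K b) → ¬ T (X b) →
                (∀ u w → T (X u) → T (K w) → T (A u w) → T (X w)) → k + count K ≤ n
    cut-bound {k} ic K X {a} {b} X⊆K Xa Kb ¬Xb closed = begin
      k + count K                     ≤⟨ ℕ.+-monoˡ-≤ (count K) k≤S ⟩
      ∣ tabulate (∁ K) ∣ + count K     ≡⟨ cong (_+ count K) (∣tabulate∣ (∁ K)) ⟩
      count (∁ K) + count K           ≡⟨ ℕ.+-comm (count (∁ K)) (count K) ⟩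
      count K + count (∁ K)           ≡⟨ count-∁ K ⟩
      n                               ∎
      where
        open ℕ.≤-Reasoning
        S : Subset n
        S = tabulate (∁ K)
        kept : ∀ {u} → T (K u) → u ∉ S
        kept Ku u∈S = T-not⁻ (∈-tabulate⁻ (∁ K) u∈S) Ku
        stays : ∀ {u v} → PathAvoid G S u v → T (X u) → T (X v)
        stays (here _)         Xu = Xu
        stays (step _ uw w⇝v) Xu =
          stays w⇝v (closed _ _ Xu (decidable-stable (T? (K _)) (path-start w⇝v ∘ ∈-tabulate⁺ (∁ K) ∘ T-not⁺)) uw)
        incomplete : ¬ IsComplete G
        incomplete complete = ¬Xb (closed a b Xa Kb (complete a b λ { refl → ¬Xb Xa }))
        k≤S : k ≤ ∣ S ∣
        k≤S = ic .proj₂ incomplete .proj₂ S (a , b , kept (X⊆K a Xa) , kept Kb , λ a⇝b → ¬Xb (stays a⇝b Xa))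

    commonNeighbour : ∀ {k} → IsConnectivity G k → n ∸ 1 ≤ 2 * k →
                      ∀ {u v} → u ≢ v → ¬ T (A u v) → ∃ λ w → T (A u w) × T (A w v)
    commonNeighbour {k} ic n∸1≤2k {u} {v} u≢v ¬uv with any? (λ w → T? (A u w ∧ A v w))
    ... | yes (w , uw∧vw) = w , T-∧ .to uw∧vw .proj₁ , subst T (adj-sym G v w) (T-∧ .to uw∧vw .proj₂)
    ... | no  none = contradiction (begin-strict
      suc (2 * k)
        <⟨ ℕ.n<1+n _ ⟩
      suc (suc (2 * k))
        ≡⟨ rearrange k ⟩
      suc k + suc k
        ≤⟨ ℕ.+-mono-≤ (s≤s (connectivity≤deg ic u)) (s≤s (connectivity≤deg ic v)) ⟩
      suc (deg G u) + suc (deg G v)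
        ≡⟨ cong₂ _+_ (count-N[] u) (count-N[] v) ⟨
      count N[ u ] + count N[ v ]
        ≡⟨ count-∪ N[ u ] N[ v ] disjoint ⟨
      count (N[ u ] ∪ N[ v ])
        ≤⟨ count≤n (N[ u ] ∪ N[ v ]) ⟩
      n
        ≤⟨ ℕ.m≤n+m∸n n 1 ⟩
      suc (n ∸ 1)
        ≤⟨ s≤s n∸1≤2k ⟩
      suc (2 * k) ∎) (ℕ.<-irrefl refl)
      where
        open ℕ.≤-Reasoning
        rearrange : ∀ k → suc (suc (2 * k)) ≡ suc k + suc k
        rearrange = solve-∀
        disjoint : Disjoint N[ u ] N[ v ]
        disjoint i i∈N[u] i∈N[v] with T-∨ .to i∈N[u] | T-∨ .to i∈N[v]
        ... | inj₁ ui | inj₁ vi = none (i , T-∧ .from (ui , vi))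
        ... | inj₁ ui | inj₂ i=v = ¬uv (subst (T ∘ A u) (∈⁅⁆⇒≡ i=v) ui)
        ... | inj₂ i=u | inj₁ vi = ¬uv (subst T (adj-sym G v u) (subst (T ∘ A v) (∈⁅⁆⇒≡ i=u) vi))
        ... | inj₂ i=u | inj₂ i=v = u≢v (trans (sym (∈⁅⁆⇒≡ i=u)) (∈⁅⁆⇒≡ i=v))

    diameter≤2 : ∀ {k} → IsConnectivity G k → n ∸ 1 ≤ 2 * k → ∀ u v → dist G u v ≤ 2
    diameter≤2 ic n∸1≤2k u v with u ≟ v | T? (A u v)
    ... | yes refl | _      = ℕ.≤-trans (ℕ.≤-reflexive (dist-refl u)) z≤n
    ... | no  _    | yes uv = ℕ.≤-trans (ℕ.≤-reflexive (dist-adj uv)) (s≤s z≤n)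
    ... | no  u≢v  | no ¬uv with commonNeighbour ic n∸1≤2k u≢v ¬uv
    ...   | w , uw , wv = dist-≤ 2 (reach-step {1} uw (reach-step {0} wv (reach-refl v)))

module EdgeNeighbourhood where

  open import Data.Bool using (Bool; T; _∧_; _∨_)
  open import Data.Bool.Properties using (T-∧; T-∨; T-≡; ∧-comm; ∧-identityʳ; ∨-identityʳ; ∨-zeroʳ)
  open import Data.Empty using (⊥-elim)
  open import Data.Fin using (Fin; _≟_)
  open import Data.Nat using (ℕ; suc; _+_; _*_; _∸_; _≤_; z≤n; s≤s)
  import Data.Nat.Properties as ℕ
  open import Data.Nat.Tactic.RingSolver using (solve-∀)
  open import Data.Product using (_,_; proj₁; proj₂)
  open import Data.Sum using (inj₁; inj₂)
  open import Function using (_∘_)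
  open import Function.Bundles using (module Equivalence)
  open import Relation.Binary.PropositionalEquality using (_≡_; _≢_; refl; sym; trans; cong; subst; module ≡-Reasoning)
  open import Relation.Nullary using (¬_; yes; no)
  open import Relation.Nullary.Decidable using (T?)

  open import Defs
  open Counting
  open Hall
  open Connectivity
  open Equivalence using (to; from)

  module _ {n : ℕ} (G : Graph n) where

    private
      A : Fin n → Fin n → Bool
      A = adj G

    deg-split : ∀ {u v} → T (A u v) → deg G u ≡ suc (count (A u ∩ A v) + count (A u ─ N[ G ] v))
    deg-split {u} {v} uv = begin
      deg G u
        ≡⟨ deg≡count G u ⟩
      count (A u)
        ≡⟨ count-∩-─ (A u) (N[ G ] v) ⟩
      count (A u ∩ N[ G ] v) + count (A u ─ N[ G ] v)
        ≡⟨ cong (_+ count (A u ─ N[ G ] v)) (count-cong split) ⟩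
      count ((A u ∩ A v) ∪ ⁅ v ⁆) + count (A u ─ N[ G ] v)
        ≡⟨ cong (_+ count (A u ─ N[ G ] v)) (count-∪ (A u ∩ A v) ⁅ v ⁆ v∉N[v]) ⟩
      count (A u ∩ A v) + count ⁅ v ⁆ + count (A u ─ N[ G ] v)
        ≡⟨ cong (λ c → count (A u ∩ A v) + c + count (A u ─ N[ G ] v)) (count-⁅⁆ v) ⟩
      count (A u ∩ A v) + 1 + count (A u ─ N[ G ] v)
        ≡⟨ cong (_+ count (A u ─ N[ G ] v)) (ℕ.+-comm _ 1) ⟩
      suc (count (A u ∩ A v) + count (A u ─ N[ G ] v)) ∎
      where
        open ≡-Reasoning
        split : ∀ i → (A u ∩ N[ G ] v) i ≡ ((A u ∩ A v) ∪ ⁅ v ⁆) i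
        split i with i ≟ v
        ... | yes refl = trans (cong (A u i ∧_) (∨-zeroʳ (A i i)))
                           (trans (∧-identityʳ (A u i)) (trans (T-≡ .to uv) (sym (∨-zeroʳ _))))
        ... | no  _    = trans (cong (A u i ∧_) (∨-identityʳ (A v i))) (sym (∨-identityʳ _))
        v∉N[v] : Disjoint (A u ∩ A v) ⁅ v ⁆
        v∉N[v] i uvi i=v = subst T (irrefl G v) (subst (T ∘ A v) (∈⁅⁆⇒≡ i=v) (T-∧ {A u i} .to uvi .proj₂))

    ─N[]⇒¬adj : ∀ {P v u} → T ((P ─ N[ G ] v) u) → ¬ T (A v u)
    ─N[]⇒¬adj {P} {v} {u} h vu = T-not⁻ (T-∧ {P u} .to h .proj₂) (T-∨ .from (inj₁ vu))

    ─N[]⇒≢ : ∀ {P v u} → T ((P ─ N[ G ] v) u) → u ≢ v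
    ─N[]⇒≢ {P} {v} {u} h u=v = T-not⁻ (T-∧ {P u} .to h .proj₂) (T-∨ {A v u} .from (inj₂ (≡⇒∈⁅⁆ u=v)))

    module _ {k : ℕ} (ic : IsConnectivity G k) {x y : Fin n} (xy : T (A x y)) where

      private
        yx : T (A y x)
        yx = subst T (adj-sym G x y) xy

      common privateX privateY : Fin n → Bool
      common   = A x ∩ A y
      privateX = A x ─ N[ G ] y
      privateY = A y ─ N[ G ] x

      deg-x : deg G x ≡ suc (count common + count privateX)
      deg-x = deg-split xy

      deg-y : deg G y ≡ suc (count common + count privateY)
      deg-y = trans (deg-split yx) (cong (λ c → suc (c + count privateY)) (count-cong λ i → ∧-comm (A y i) (A x i)))

      order-bound : suc (deg G x) + count privateY ≤ n
      order-bound = subst (_≤ n)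
        (trans (count-∪ (N[ G ] x) privateY (Disjoint-─ (A y) (N[ G ] x))) (cong (_+ count privateY) (count-N[] G x)))
        (count≤n (N[ G ] x ∪ privateY))

      threshold : ℕ
      threshold = suc (k + count privateY)

      threshold≤n : threshold ≤ n
      threshold≤n = ℕ.≤-trans (s≤s (ℕ.+-monoˡ-≤ (count privateY) (connectivity≤deg G ic x))) order-bound

      NX : (Fin n → Bool) → Fin n → Bool
      NX = nbhd A privateY

      y∉privateX : ¬ T (privateX y)
      y∉privateX Axy = ─N[]⇒≢ {A x} Axy refl

      x∉privateY : ¬ T (privateY x)
      x∉privateY Byx = ─N[]⇒≢ {A y} Byx refl

      y∉privateY : ¬ T (privateY y)
      y∉privateY Byy = subst T (irrefl G y) (T-∧ .to Byy .proj₁)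

      privateX∩[y∪privateY]=∅ : Disjoint privateX (⁅ y ⁆ ∪ privateY)
      privateX∩[y∪privateY]=∅ i Axi yBi with T-∨ .to yBi
      ... | inj₁ i=y = y∉privateX (subst (T ∘ privateX) (∈⁅⁆⇒≡ i=y) Axi)
      ... | inj₂ Bi  = ─N[]⇒¬adj {A x} Axi (T-∧ .to Bi .proj₁)

      count-X∪y∪privateY : ∀ X → X ⊆ privateX → count (X ∪ ⁅ y ⁆ ∪ privateY) ≡ count X + (1 + count privateY)
      count-X∪y∪privateY X X⊆Ax = begin
        count (X ∪ ⁅ y ⁆ ∪ privateY)
          ≡⟨ count-∪ X (⁅ y ⁆ ∪ privateY) (λ i → privateX∩[y∪privateY]=∅ i ∘ X⊆Ax i) ⟩
        count X + count (⁅ y ⁆ ∪ privateY)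
          ≡⟨ cong (count X +_) (count-∪ ⁅ y ⁆ privateY y∩B=∅) ⟩
        count X + (count ⁅ y ⁆ + count privateY)
          ≡⟨ cong (λ c → count X + (c + count privateY)) (count-⁅⁆ y) ⟩
        count X + (1 + count privateY) ∎
        where
          open ≡-Reasoning
          y∩B=∅ : Disjoint ⁅ y ⁆ privateY
          y∩B=∅ i i=y = y∉privateY ∘ subst (T ∘ privateY) (∈⁅⁆⇒≡ i=y)

      kept : (Fin n → Bool) → Fin n → Bool
      kept X = X ∪ ⁅ y ⁆ ∪ (privateY ─ NX X)

      kept-covers : ∀ X → (X ∪ ⁅ y ⁆ ∪ privateY) ⊆ (kept X ∪ NX X)
      kept-covers X i XyBi with T-∨ {X i} .to XyBi
      ... | inj₁ Xi = T-∨ .from (inj₁ (T-∨ .from (inj₁ Xi)))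
      ... | inj₂ yBi with T-∨ {⁅ y ⁆ i} .to yBi | T? (NX X i)
      ...   | inj₁ i=y | _        = T-∨ .from (inj₁ (T-∨ {X i} .from (inj₂ (T-∨ {⁅ y ⁆ i} .from (inj₁ i=y)))))
      ...   | inj₂ _   | yes NXi  = T-∨ {kept X i} .from (inj₂ NXi)
      ...   | inj₂ Bi  | no  ¬NXi =
        T-∨ .from (inj₁ (T-∨ {X i} .from (inj₂ (T-∨ {⁅ y ⁆ i} .from (inj₂ (T-∧ .from (Bi , T-not⁺ ¬NXi)))))))

      kept-closed : ∀ X → X ⊆ privateX → ∀ u w → T (X u) → T (kept X w) → T (A u w) → T (X w)
      kept-closed X X⊆Ax u w Xu Kw uw with T-∨ .to Kw
      ... | inj₁ Xw = Xw
      ... | inj₂ yBw with T-∨ .to yBw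
      ...   | inj₁ w=y  = ⊥-elim (─N[]⇒¬adj {A x} (X⊆Ax u Xu) (subst T (adj-sym G u y) (subst (T ∘ A u) (∈⁅⁆⇒≡ w=y) uw)))
      ...   | inj₂ B∖NX = ⊥-elim (T-not⁻ (T-∧ .to B∖NX .proj₂) (∈nbhd⁺ A {privateY} {X} (T-∧ .to B∖NX .proj₁) Xu uw))

      -- The vertices outside kept X separate X from y, so there are at least k of them.
      separated : ∀ X → X ⊆ privateX → ∀ {a} → T (X a) → count X + threshold ≤ n + count (NX X)
      separated X X⊆Ax {a} Xa = begin
        count X + threshold                      ≡⟨ rearrange (count X) k (count privateY) ⟩
        k + (count X + (1 + count privateY))     ≡⟨ cong (k +_) (count-X∪y∪privateY X X⊆Ax) ⟨
        k + count (X ∪ ⁅ y ⁆ ∪ privateY)          ≤⟨ ℕ.+-monoʳ-≤ k (count-mono _ (kept X ∪ NX X) (kept-covers X)) ⟩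
        k + count (kept X ∪ NX X)                ≤⟨ ℕ.+-monoʳ-≤ k (count-∪-≤ (kept X) (NX X)) ⟩
        k + (count (kept X) + count (NX X))      ≡⟨ ℕ.+-assoc k (count (kept X)) (count (NX X)) ⟨
        k + count (kept X) + count (NX X)        ≤⟨ ℕ.+-monoˡ-≤ (count (NX X)) k+kept≤n ⟩
        n + count (NX X)                         ∎
        where
          open ℕ.≤-Reasoning
          rearrange : ∀ a k b → a + suc (k + b) ≡ k + (a + (1 + b))
          rearrange = solve-∀
          y∈kept : T (kept X y)
          y∈kept = T-∨ {X y} .from (inj₂ (T-∨ {⁅ y ⁆ y} .from (inj₁ (≡⇒∈⁅⁆ refl))))
          k+kept≤n : k + count (kept X) ≤ n
          k+kept≤n = cut-bound G ic (kept X) X (λ i Xi → T-∨ .from (inj₁ Xi)) Xa y∈kept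
                       (y∉privateX ∘ X⊆Ax y) (kept-closed X X⊆Ax)

      deficiency : ℕ
      deficiency = n ∸ threshold

      hallCondition : HallCondition A deficiency privateX privateY
      hallCondition X X⊆Ax with 0 ℕ.<? count X
      ... | no  X≯0 = ℕ.≤-trans (ℕ.≮⇒≥ X≯0) z≤n
      ... | yes 0<X with count>0⇒∃ X 0<X
      ...   | a , Xa = ℕ.+-cancelʳ-≤ threshold _ _ (begin
        count X + threshold                     ≤⟨ separated X X⊆Ax Xa ⟩
        n + count (NX X)                        ≡⟨ cong (_+ count (NX X)) (ℕ.m∸n+n≡m threshold≤n) ⟨
        deficiency + threshold + count (NX X)   ≡⟨ rearrange deficiency threshold (count (NX X)) ⟩
        count (NX X) + deficiency + threshold   ∎)
        where
          open ℕ.≤-Reasoning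
          rearrange : ∀ d c N → d + c + N ≡ N + d + c
          rearrange = solve-∀

      matching : DeficientMatching A deficiency privateX privateY
      matching = hall A hallCondition

      matched : Matching A privateX privateY
      matched = proj₁ matching

      key-inequality : deg G x + 2 * k ≤ n + 1 + 2 * count common + Matching.size matched
      key-inequality = ℕ.+-cancelʳ-≤ (suc b) _ _ (begin
        deg G x + 2 * k + suc b
          ≡⟨ cong (λ d → d + 2 * k + suc b) deg-x ⟩
        suc (c + a) + 2 * k + suc b
          ≡⟨ rearrange₁ a b c k ⟩
        a + threshold + suc (c + k)
          ≤⟨ ℕ.+-mono-≤ a+threshold≤m+n (s≤s (ℕ.+-monoʳ-≤ c (connectivity≤deg G ic y))) ⟩
        m + n + suc (c + deg G y)
          ≡⟨ cong (λ d → m + n + suc (c + d)) deg-y ⟩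
        m + n + suc (c + suc (c + b))
          ≡⟨ rearrange₂ b c m n ⟩
        n + 1 + 2 * c + m + suc b ∎)
        where
          open ℕ.≤-Reasoning
          a b c m : ℕ
          a = count privateX
          b = count privateY
          c = count common
          m = Matching.size matched
          a+threshold≤m+n : a + threshold ≤ m + n
          a+threshold≤m+n = begin
            a + threshold                  ≤⟨ ℕ.+-monoˡ-≤ threshold (proj₂ matching) ⟩
            m + deficiency + threshold     ≡⟨ ℕ.+-assoc m deficiency threshold ⟩
            m + (deficiency + threshold)   ≡⟨ cong (m +_) (ℕ.m∸n+n≡m threshold≤n) ⟩
            m + n                    ∎
          rearrange₁ : ∀ a b c k → suc (c + a) + 2 * k + suc b ≡ a + suc (k + b) + suc (c + k)
          rearrange₁ = solve-∀
          rearrange₂ : ∀ b c m n → m + n + suc (c + suc (c + b)) ≡ n + 1 + 2 * c + m + suc b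
          rearrange₂ = solve-∀

module Rationals where

  open import Algebra.Bundles using (CommutativeRing)
  open import Data.Bool using (Bool; true; false; T; if_then_else_; _∧_; _∨_)
  open import Data.Empty using (⊥-elim)
  open import Data.Fin using (Fin; zero; suc; _≟_)
  import Data.Integer as ℤ
  import Data.Integer.Properties as ℤ
  open import Data.Integer.Tactic.RingSolver using (solve-∀)
  open import Data.Nat as ℕ using (ℕ; zero; suc)
  import Data.Nat.Properties as ℕ
  open import Data.Rational using (ℚ; _/_; 0ℚ; 1ℚ; _+_; _*_; _-_; -_; _≤_; 1/_; Positive; nonNegative; ≢-nonZero; toℚᵘ)
  import Data.Rational.Properties as ℚ
  open import Data.Rational.Solver using (module +-*-Solver)
  import Data.Rational.Unnormalised as ℚᵘ
  import Data.Rational.Unnormalised.Properties as ℚᵘ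
  open import Function using (_∘_)
  open import Relation.Binary.PropositionalEquality using (_≡_; refl; sym; trans; cong; cong₂; subst; subst₂; module ≡-Reasoning)
  open import Relation.Nullary using (¬_; Dec; yes; no)

  open FiniteSums
  open Counting using (count; indicator; ⁅_⁆; ∈⁅⁆⇒≡; ≡⇒∈⁅⁆)
  open CommutativeMonoidSum ℚ.+-0-commutativeMonoid public
    using (sum; ∑-distrib-+; ∑-comm; sum-cong-≗; sum-zero; sum-single)
  open import Algebra.Properties.Semiring.Sum (CommutativeRing.semiring ℚ.+-*-commutativeRing) public
    using (*-distribˡ-sum; *-distribʳ-sum)
  open +-*-Solver

  private
    variable
      n : ℕ

  fromℕ : ℕ → ℚ
  fromℕ m = ℤ.+ m / 1

  fromℕ-+ : ∀ a b → fromℕ (a ℕ.+ b) ≡ fromℕ a + fromℕ b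
  fromℕ-+ a b = ℚ.toℚᵘ-injective (begin
    toℚᵘ (fromℕ (a ℕ.+ b))
      ≈⟨ ℚ.toℚᵘ-fromℚᵘ (ℚᵘ.mkℚᵘ (ℤ.+ (a ℕ.+ b)) 0) ⟩
    ℚᵘ.mkℚᵘ (ℤ.+ (a ℕ.+ b)) 0
      ≈⟨ ℚᵘ.*≡* (trans (cong (ℤ._* ℤ.+ 1) (ℤ.pos-+ a b)) (cross-multiply (ℤ.+ a) (ℤ.+ b))) ⟩
    ℚᵘ.mkℚᵘ (ℤ.+ a) 0 ℚᵘ.+ ℚᵘ.mkℚᵘ (ℤ.+ b) 0
      ≈⟨ ℚᵘ.+-cong (ℚ.toℚᵘ-fromℚᵘ (ℚᵘ.mkℚᵘ (ℤ.+ a) 0)) (ℚ.toℚᵘ-fromℚᵘ (ℚᵘ.mkℚᵘ (ℤ.+ b) 0)) ⟨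
    toℚᵘ (fromℕ a) ℚᵘ.+ toℚᵘ (fromℕ b)
      ≈⟨ ℚ.toℚᵘ-homo-+ (fromℕ a) (fromℕ b) ⟨
    toℚᵘ (fromℕ a + fromℕ b) ∎)
    where
      open ℚᵘ.≃-Reasoning
      cross-multiply : ∀ i j → (i ℤ.+ j) ℤ.* ℤ.+ 1 ≡ (i ℤ.* ℤ.+ 1 ℤ.+ j ℤ.* ℤ.+ 1) ℤ.* ℤ.+ 1
      cross-multiply = solve-∀

  fromℕ-nonNeg : ∀ m → 0ℚ ≤ fromℕ m
  fromℕ-nonNeg m = ℚ.nonNegative⁻¹ (fromℕ m) {{ℚ.normalize-nonNeg m 1}}

  ≤-+-nonNeg : ∀ {p q} → 0ℚ ≤ q → p ≤ p + q
  ≤-+-nonNeg {p} {q} 0≤q = subst (_≤ p + q) (ℚ.+-identityʳ p) (ℚ.+-monoʳ-≤ p 0≤q)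

  fromℕ-mono-≤ : ∀ {a b} → a ℕ.≤ b → fromℕ a ≤ fromℕ b
  fromℕ-mono-≤ {a} {b} a≤b = subst (fromℕ a ≤_) (trans (sym (fromℕ-+ a (b ℕ.∸ a))) (cong fromℕ (ℕ.m+[n∸m]≡n a≤b)))
    (≤-+-nonNeg (fromℕ-nonNeg (b ℕ.∸ a)))

  0≤-⇒≤ : ∀ {p q} → 0ℚ ≤ q - p → p ≤ q
  0≤-⇒≤ {p} {q} 0≤q-p = subst₂ _≤_ (ℚ.+-identityˡ p) (solve 2 (λ p q → (q :- p) :+ p := q) refl p q) (ℚ.+-monoˡ-≤ p 0≤q-p)

  ≤⇒0≤- : ∀ {p q} → p ≤ q → 0ℚ ≤ q - p
  ≤⇒0≤- {p} {q} p≤q = subst (_≤ q - p) (ℚ.+-inverseʳ p) (ℚ.+-monoˡ-≤ (- p) p≤q)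

  *-nonNeg : ∀ {p q} → 0ℚ ≤ p → 0ℚ ≤ q → 0ℚ ≤ p * q
  *-nonNeg {p} {q} 0≤p 0≤q = subst (_≤ p * q) (ℚ.*-zeroʳ p) (ℚ.*-monoˡ-≤-nonNeg p {{nonNegative 0≤p}} 0≤q)

  +-nonNeg : ∀ {p q} → 0ℚ ≤ p → 0ℚ ≤ q → 0ℚ ≤ p + q
  +-nonNeg {p} {q} 0≤p 0≤q = subst (_≤ p + q) (ℚ.+-identityˡ 0ℚ) (ℚ.+-mono-≤ 0≤p 0≤q)

  *-monoˡ-≤ : ∀ {r p q} → 0ℚ ≤ r → p ≤ q → r * p ≤ r * q
  *-monoˡ-≤ {r} 0≤r = ℚ.*-monoˡ-≤-nonNeg r {{nonNegative 0≤r}}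

  infixl 7 _when_

  _when_ : ℚ → Bool → ℚ
  r when b = if b then r else 0ℚ

  when-nonNeg : ∀ {r} b → 0ℚ ≤ r → 0ℚ ≤ r when b
  when-nonNeg true  0≤r = 0≤r
  when-nonNeg false _   = ℚ.≤-refl

  when-mono-≤ : ∀ {r s} b → r ≤ s → r when b ≤ s when b
  when-mono-≤ true  r≤s = r≤s
  when-mono-≤ false _   = ℚ.≤-refl

  when-+ : ∀ r s b → (r + s) when b ≡ r when b + s when b
  when-+ r s true  = refl
  when-+ r s false = sym (ℚ.+-identityˡ 0ℚ)

  when-∧ : ∀ r a b → r when (a ∧ b) ≡ (r when a) when b
  when-∧ r true  b     = refl
  when-∧ r false true  = refl
  when-∧ r false false = refl

  when-T : ∀ {r b} → T b → r when b ≡ r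
  when-T {b = true} _ = refl

  when-¬T : ∀ {r b} → ¬ T b → r when b ≡ 0ℚ
  when-¬T {b = true}  ¬b = ⊥-elim (¬b _)
  when-¬T {b = false} _  = refl

  when-∨ : ∀ r {a b} → (T a → ¬ T b) → r when (a ∨ b) ≡ r when a + r when b
  when-∨ r {true}  {true}  a⇒¬b = ⊥-elim (a⇒¬b _ _)
  when-∨ r {true}  {false} _    = sym (ℚ.+-identityʳ r)
  when-∨ r {false}         _    = sym (ℚ.+-identityˡ _)

  when-⊆ : ∀ {r} {a b} → 0ℚ ≤ r → (T a → T b) → r when a ≤ r when b
  when-⊆ {a = true}  {true}  _   _   = ℚ.≤-refl
  when-⊆ {a = true}  {false} _   a⇒b = ⊥-elim (a⇒b _)
  when-⊆ {a = false} {b}     0≤r _   = when-nonNeg b 0≤r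

  *-when-≤ : ∀ {a r} b → 0ℚ ≤ r → (T b → a ≤ 1ℚ) → a * (r when b) ≤ r when b
  *-when-≤ {a} {r} true  0≤r a≤1 = subst (a * r ≤_) (ℚ.*-identityˡ r) (ℚ.*-monoʳ-≤-nonNeg r {{nonNegative 0≤r}} (a≤1 _))
  *-when-≤ {a}     false _   _   = ℚ.≤-reflexive (ℚ.*-zeroʳ a)

  *-when-0 : ∀ {a r} b → (T b → a ≡ 0ℚ) → a * (r when b) ≡ 0ℚ
  *-when-0 {a} {r} true  a≡0 = trans (cong (_* r) (a≡0 _)) (ℚ.*-zeroˡ r)
  *-when-0 {a}     false _   = ℚ.*-zeroʳ a

  when≡fromℕ* : ∀ r b → r when b ≡ fromℕ (indicator b) * r
  when≡fromℕ* r true  = sym (ℚ.*-identityˡ r)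
  when≡fromℕ* r false = sym (ℚ.*-zeroˡ r)

  sum-mono-≤ : ∀ {f g : Fin n → ℚ} → (∀ i → f i ≤ g i) → sum f ≤ sum g
  sum-mono-≤ {zero}  f≤g = ℚ.≤-refl
  sum-mono-≤ {suc n} f≤g = ℚ.+-mono-≤ (f≤g zero) (sum-mono-≤ (f≤g ∘ suc))

  sum-nonNeg : ∀ {f : Fin n → ℚ} → (∀ i → 0ℚ ≤ f i) → 0ℚ ≤ sum f
  sum-nonNeg {zero}  0≤f = ℚ.≤-refl
  sum-nonNeg {suc n} 0≤f = +-nonNeg (0≤f zero) (sum-nonNeg (0≤f ∘ suc))

  term≤sum : ∀ {f : Fin n → ℚ} → (∀ i → 0ℚ ≤ f i) → ∀ j → f j ≤ sum f
  term≤sum {suc n} {f} 0≤f zero    = ≤-+-nonNeg (sum-nonNeg (0≤f ∘ suc))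
  term≤sum {suc n} {f} 0≤f (suc j) =
    ℚ.≤-trans (term≤sum (0≤f ∘ suc) j)
      (subst (_≤ f zero + sum (f ∘ suc)) (ℚ.+-identityˡ _) (ℚ.+-monoˡ-≤ (sum (f ∘ suc)) (0≤f zero)))

  nonNeg-sum≡0 : ∀ {f : Fin n → ℚ} → (∀ i → 0ℚ ≤ f i) → sum f ≡ 0ℚ → ∀ j → f j ≡ 0ℚ
  nonNeg-sum≡0 0≤f ∑f≡0 j = ℚ.≤-antisym (subst (_ ≤_) ∑f≡0 (term≤sum 0≤f j)) (0≤f j)

  sum-─ : ∀ (f g : Fin n → ℚ) → sum (λ i → f i - g i) ≡ sum f - sum g
  sum-─ f g = begin
    sum (λ i → f i - g i)
      ≡⟨ solve 2 (λ a b → a := a :+ b :- b) refl _ (sum g) ⟩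
    sum (λ i → f i - g i) + sum g - sum g
      ≡⟨ cong (_- sum g) (∑-distrib-+ (λ i → f i - g i) g) ⟨
    sum (λ i → f i - g i + g i) - sum g
      ≡⟨ cong (_- sum g) (sum-cong-≗ λ i → solve 2 (λ a b → a :- b :+ b := a) refl (f i) (g i)) ⟩
    sum f - sum g ∎
    where open ≡-Reasoning

  sum-when : ∀ (P : Fin n → Bool) r → sum (λ i → r when P i) ≡ fromℕ (count P) * r
  sum-when {zero}  P r = sym (ℚ.*-zeroˡ r)
  sum-when {suc n} P r = begin
    r when P zero + sum (λ i → r when P (suc i))
      ≡⟨ cong₂ _+_ (when≡fromℕ* r (P zero)) (sum-when (P ∘ suc) r) ⟩
    fromℕ (indicator (P zero)) * r + fromℕ (count (P ∘ suc)) * r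
      ≡⟨ ℚ.*-distribʳ-+ r (fromℕ (indicator (P zero))) (fromℕ (count (P ∘ suc))) ⟨
    (fromℕ (indicator (P zero)) + fromℕ (count (P ∘ suc))) * r
      ≡⟨ cong (_* r) (fromℕ-+ (indicator (P zero)) (count (P ∘ suc))) ⟨
    fromℕ (count P) * r ∎
    where open ≡-Reasoning

  sum-δ : ∀ (f : Fin n → ℚ) j → sum (λ i → f i when ⁅ j ⁆ i) ≡ f j
  sum-δ f j = trans (sum-single j λ i i≢j → when-¬T (i≢j ∘ ∈⁅⁆⇒≡)) (when-T (≡⇒∈⁅⁆ refl))

  sum-δ′ : ∀ (f : Fin n → ℚ) j → sum (λ i → f i when ⁅ i ⁆ j) ≡ f j
  sum-δ′ f j = trans (sum-single j λ i i≢j → when-¬T (i≢j ∘ sym ∘ ∈⁅⁆⇒≡)) (when-T (≡⇒∈⁅⁆ refl))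

  1/₀_ : ℚ → ℚ
  1/₀ p with p ℚ.≟ 0ℚ
  ... | yes _   = 0ℚ
  ... | no  p≢0 = (1/ p) {{≢-nonZero p≢0}}

  1/₀-nonNeg : ∀ {p} → 0ℚ ≤ p → 0ℚ ≤ 1/₀ p
  1/₀-nonNeg {p} 0≤p with p ℚ.≟ 0ℚ
  ... | yes _   = ℚ.≤-refl
  ... | no  p≢0 = ℚ.<⇒≤ (ℚ.positive⁻¹ _ {{ℚ.1/pos⇒pos p {{positive-p}}}})
    where
      positive-p : Positive p
      positive-p = ℚ.nonNeg∧nonZero⇒pos p {{nonNegative 0≤p}} {{≢-nonZero p≢0}}

  *-1/₀ : ∀ {p} → ¬ p ≡ 0ℚ → p * 1/₀ p ≡ 1ℚ
  *-1/₀ {p} p≢0 with p ℚ.≟ 0ℚ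
  ... | yes p≡0 = ⊥-elim (p≢0 p≡0)
  ... | no  p≢0 = ℚ.*-inverseʳ p {{≢-nonZero p≢0}}

  proportional : ∀ {f : Fin n → ℚ} → (∀ i → 0ℚ ≤ f i) → ∀ i → f i * (sum f * 1/₀ sum f) ≡ f i
  proportional {f = f} 0≤f i = by-cases (sum f ℚ.≟ 0ℚ)
    where
      by-cases : Dec (sum f ≡ 0ℚ) → f i * (sum f * 1/₀ sum f) ≡ f i
      by-cases (yes ∑f≡0) = trans (cong (_* (sum f * 1/₀ sum f)) fi≡0) (trans (ℚ.*-zeroˡ (sum f * 1/₀ sum f)) (sym fi≡0))
        where
          fi≡0 : f i ≡ 0ℚ
          fi≡0 = nonNeg-sum≡0 0≤f ∑f≡0 i
      by-cases (no ∑f≢0) = trans (cong (f i *_) (*-1/₀ ∑f≢0)) (ℚ.*-identityʳ (f i))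

  fromℕ-2* : ∀ a → fromℕ (2 ℕ.* a) ≡ fromℕ a + fromℕ a
  fromℕ-2* a = trans (cong (λ b → fromℕ (a ℕ.+ b)) (ℕ.+-identityʳ a)) (fromℕ-+ a a)

module SubCouplings where

  open import Data.Fin using (Fin)
  open import Data.List using (foldr)
  open import Data.List.Properties using (map-tabulate)
  open import Data.Nat as ℕ using (ℕ)
  open import Data.Product using (_,_)
  open import Data.Rational using (ℚ; 0ℚ; 1ℚ; _+_; _*_; _-_; _≤_; nonNegative)
  import Data.Rational.Properties as ℚ
  open import Data.Rational.Solver using (module +-*-Solver)
  open import Relation.Binary.PropositionalEquality using (_≡_; refl; sym; trans; cong; cong₂; subst; module ≡-Reasoning)

  open import Defs
  open FiniteSums using (foldr-tabulate)
  open Rationals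
  open +-*-Solver

  module _ {n : ℕ} (G : Graph n) where

    sumℚ≡sum : ∀ f → sumℚ G f ≡ sum f
    sumℚ≡sum f = trans (cong (foldr _+_ 0ℚ) (map-tabulate (λ i → i) f)) (foldr-tabulate _+_ 0ℚ f)

    cost≡ : ∀ π → cost G π ≡ sum (λ u → sum (λ v → fromℕ (dist G u v) * π u v))
    cost≡ π = trans (sumℚ≡sum _) (sum-cong-≗ λ u → sumℚ≡sum (λ v → fromℕ (dist G u v) * π u v))

    mass : (Fin n → Fin n → ℚ) → ℚ
    mass P = sum (λ u → sum (P u))

    cost-+ : ∀ P Q → cost G (λ u v → P u v + Q u v) ≡ cost G P + cost G Q
    cost-+ P Q = begin
      cost G (λ u v → P u v + Q u v)
        ≡⟨ cost≡ (λ u v → P u v + Q u v) ⟩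
      sum (λ u → sum (λ v → d u v * (P u v + Q u v)))
        ≡⟨ sum-cong-≗ (λ u → trans (sum-cong-≗ (distrib u)) (∑-distrib-+ (dP u) (dQ u))) ⟩
      sum (λ u → sum (dP u) + sum (dQ u))
        ≡⟨ ∑-distrib-+ (λ u → sum (dP u)) (λ u → sum (dQ u)) ⟩
      sum (λ u → sum (dP u)) + sum (λ u → sum (dQ u))
        ≡⟨ cong₂ _+_ (cost≡ P) (cost≡ Q) ⟨
      cost G P + cost G Q ∎
      where
        open ≡-Reasoning
        d dP dQ : Fin n → Fin n → ℚ
        d u v  = fromℕ (dist G u v)
        dP u v = d u v * P u v
        dQ u v = d u v * Q u v
        distrib : ∀ u v → d u v * (P u v + Q u v) ≡ dP u v + dQ u v
        distrib u v = ℚ.*-distribˡ-+ (d u v) (P u v) (Q u v)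

    cost≤diameter*mass : ∀ {D} → (∀ u v → dist G u v ℕ.≤ D) → ∀ P → (∀ u v → 0ℚ ≤ P u v) →
                         cost G P ≤ fromℕ D * mass P
    cost≤diameter*mass {D} diam P 0≤P = begin
      cost G P                                          ≡⟨ cost≡ P ⟩
      sum (λ u → sum (λ v → fromℕ (dist G u v) * P u v)) ≤⟨ sum-mono-≤ (λ u → sum-mono-≤ (dist≤D u)) ⟩
      sum (λ u → sum (λ v → fromℕ D * P u v))            ≡⟨ sum-cong-≗ (λ u → *-distribˡ-sum (fromℕ D) (P u)) ⟨
      sum (λ u → fromℕ D * sum (P u))                    ≡⟨ *-distribˡ-sum (fromℕ D) (λ u → sum (P u)) ⟨
      fromℕ D * mass P                                  ∎
      where
        open ℚ.≤-Reasoning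
        dist≤D : ∀ u v → fromℕ (dist G u v) * P u v ≤ fromℕ D * P u v
        dist≤D u v = ℚ.*-monoʳ-≤-nonNeg (P u v) {{nonNegative (0≤P u v)}} (fromℕ-mono-≤ (diam u v))

    record SubCoupling (μ₁ μ₂ : Fin n → ℚ) (P : Fin n → Fin n → ℚ) : Set where
      field
        nonNeg : ∀ u v → 0ℚ ≤ P u v
        rows≤  : ∀ u → sum (P u) ≤ μ₁ u
        cols≤  : ∀ v → sum (λ u → P u v) ≤ μ₂ v

    module Completion {μ₁ μ₂ : Fin n → ℚ} {P : Fin n → Fin n → ℚ}
                      (∑μ₁≡1 : sum μ₁ ≡ 1ℚ) (∑μ₂≡1 : sum μ₂ ≡ 1ℚ) (sub : SubCoupling μ₁ μ₂ P) where

      open SubCoupling sub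

      rowDeficit colDeficit : Fin n → ℚ
      rowDeficit u = μ₁ u - sum (P u)
      colDeficit v = μ₂ v - sum (λ u → P u v)

      deficit : ℚ
      deficit = 1ℚ - mass P

      ∑rowDeficit : sum rowDeficit ≡ deficit
      ∑rowDeficit = trans (sum-─ μ₁ (λ u → sum (P u))) (cong (_- mass P) ∑μ₁≡1)

      ∑colDeficit : sum colDeficit ≡ deficit
      ∑colDeficit = trans (sum-─ μ₂ (λ v → sum (λ u → P u v)))
                          (cong₂ _-_ ∑μ₂≡1 (sym (∑-comm P)))

      rowDeficit-nonNeg : ∀ u → 0ℚ ≤ rowDeficit u
      rowDeficit-nonNeg u = ≤⇒0≤- (rows≤ u)

      colDeficit-nonNeg : ∀ v → 0ℚ ≤ colDeficit v
      colDeficit-nonNeg v = ≤⇒0≤- (cols≤ v)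

      spread : Fin n → Fin n → ℚ
      spread u v = rowDeficit u * (colDeficit v * 1/₀ deficit)

      π : Fin n → Fin n → ℚ
      π u v = P u v + spread u v

      private
        W : ℚ
        W = 1/₀ deficit

      spread-nonNeg : ∀ u v → 0ℚ ≤ spread u v
      spread-nonNeg u v = *-nonNeg (rowDeficit-nonNeg u) (*-nonNeg (colDeficit-nonNeg v) (1/₀-nonNeg 0≤deficit))
        where
          0≤deficit : 0ℚ ≤ deficit
          0≤deficit = subst (0ℚ ≤_) ∑rowDeficit (sum-nonNeg rowDeficit-nonNeg)

      spread-rows : ∀ u → sum (spread u) ≡ rowDeficit u
      spread-rows u = begin
        sum (λ v → rowDeficit u * (colDeficit v * W))
          ≡⟨ *-distribˡ-sum (rowDeficit u) (λ v → colDeficit v * W) ⟨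
        rowDeficit u * sum (λ v → colDeficit v * W)
          ≡⟨ cong (rowDeficit u *_) (*-distribʳ-sum W colDeficit) ⟨
        rowDeficit u * (sum colDeficit * W)
          ≡⟨ cong (λ d → rowDeficit u * (d * W)) (trans ∑colDeficit (sym ∑rowDeficit)) ⟩
        rowDeficit u * (sum rowDeficit * W)
          ≡⟨ cong (λ d → rowDeficit u * (sum rowDeficit * 1/₀ d)) ∑rowDeficit ⟨
        rowDeficit u * (sum rowDeficit * 1/₀ sum rowDeficit)
          ≡⟨ proportional rowDeficit-nonNeg u ⟩
        rowDeficit u ∎
        where open ≡-Reasoning

      spread-cols : ∀ v → sum (λ u → spread u v) ≡ colDeficit v
      spread-cols v = begin
        sum (λ u → rowDeficit u * (colDeficit v * W))
          ≡⟨ *-distribʳ-sum (colDeficit v * W) rowDeficit ⟨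
        sum rowDeficit * (colDeficit v * W)
          ≡⟨ solve 3 (λ a b c → a :* (b :* c) := b :* (a :* c)) refl (sum rowDeficit) (colDeficit v) W ⟩
        colDeficit v * (sum rowDeficit * W)
          ≡⟨ cong (λ d → colDeficit v * (d * W)) (trans ∑rowDeficit (sym ∑colDeficit)) ⟩
        colDeficit v * (sum colDeficit * W)
          ≡⟨ cong (λ d → colDeficit v * (sum colDeficit * 1/₀ d)) ∑colDeficit ⟨
        colDeficit v * (sum colDeficit * 1/₀ sum colDeficit)
          ≡⟨ proportional colDeficit-nonNeg v ⟩
        colDeficit v ∎
        where open ≡-Reasoning

      π-rows : ∀ u → sum (π u) ≡ μ₁ u
      π-rows u = begin
        sum (π u)                          ≡⟨ ∑-distrib-+ (P u) (spread u) ⟩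
        sum (P u) + sum (spread u)         ≡⟨ cong (sum (P u) +_) (spread-rows u) ⟩
        sum (P u) + (μ₁ u - sum (P u))     ≡⟨ solve 2 (λ r m → r :+ (m :- r) := m) refl (sum (P u)) (μ₁ u) ⟩
        μ₁ u                               ∎
        where open ≡-Reasoning

      π-cols : ∀ v → sum (λ u → π u v) ≡ μ₂ v
      π-cols v = begin
        sum (λ u → π u v)
          ≡⟨ ∑-distrib-+ (λ u → P u v) (λ u → spread u v) ⟩
        sum (λ u → P u v) + sum (λ u → spread u v)
          ≡⟨ cong (sum (λ u → P u v) +_) (spread-cols v) ⟩
        sum (λ u → P u v) + (μ₂ v - sum (λ u → P u v))
          ≡⟨ solve 2 (λ r m → r :+ (m :- r) := m) refl (sum (λ u → P u v)) (μ₂ v) ⟩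
        μ₂ v ∎
        where open ≡-Reasoning

      π-nonNeg : ∀ u v → 0ℚ ≤ π u v
      π-nonNeg u v = +-nonNeg (nonNeg u v) (spread-nonNeg u v)

      π≤1 : ∀ u v → π u v ≤ 1ℚ
      π≤1 u v = begin
        π u v       ≤⟨ term≤sum (π-nonNeg u) v ⟩
        sum (π u)   ≡⟨ π-rows u ⟩
        μ₁ u        ≤⟨ term≤sum μ₁-nonNeg u ⟩
        sum μ₁      ≡⟨ ∑μ₁≡1 ⟩
        1ℚ          ∎
        where
          open ℚ.≤-Reasoning
          μ₁-nonNeg : ∀ u → 0ℚ ≤ μ₁ u
          μ₁-nonNeg u = ℚ.≤-trans (sum-nonNeg (nonNeg u)) (rows≤ u)

      isCoupling : IsCoupling G μ₁ μ₂ π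
      isCoupling = π-nonNeg , π≤1 , (λ u → trans (sumℚ≡sum (π u)) (π-rows u))
                                  , (λ v → trans (sumℚ≡sum (λ u → π u v)) (π-cols v))

      cost-≤ : ∀ {D} → (∀ u v → dist G u v ℕ.≤ D) → cost G π ≤ cost G P + fromℕ D * deficit
      cost-≤ {D} diam = begin
        cost G π
          ≡⟨ cost-+ P spread ⟩
        cost G P + cost G spread
          ≤⟨ ℚ.+-monoʳ-≤ (cost G P) (cost≤diameter*mass diam spread spread-nonNeg) ⟩
        cost G P + fromℕ D * mass spread
          ≡⟨ cong (λ t → cost G P + fromℕ D * t) (trans (sum-cong-≗ spread-rows) ∑rowDeficit) ⟩
        cost G P + fromℕ D * deficit ∎
        where open ℚ.≤-Reasoning

module EdgeTransport where

  open import Data.Bool using (Bool; T; _∧_; _∨_)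
  open import Data.Bool.Properties using (T-∧; T-∨; ∧-comm)
  open import Data.Fin using (Fin; _≟_)
  open import Data.Fin.Properties using (any?)
  import Data.Integer as ℤ
  import Data.Integer.Properties as ℤ
  open import Data.Nat as ℕ using (ℕ; zero; suc; _∸_; z≤n)
  import Data.Nat.Properties as ℕ
  open import Data.Product using (_×_; _,_; proj₁; proj₂)
  open import Data.Rational using (ℚ; 0ℚ; 1ℚ; ½; _+_; _*_; _-_; -_; _≤_; _<_; nonNegative; toℚᵘ)
  import Data.Rational.Properties as ℚ
  open import Data.Rational.Solver using (module +-*-Solver)
  import Data.Rational.Unnormalised as ℚᵘ
  import Data.Rational.Unnormalised.Properties as ℚᵘ
  open import Data.Sum using (inj₁; inj₂)
  open import Function using (_∘_)
  open import Function.Bundles using (module Equivalence)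
  open import Relation.Binary.PropositionalEquality using (_≡_; refl; sym; trans; cong; cong₂; subst; subst₂; module ≡-Reasoning)
  open import Relation.Nullary using (¬_; yes; no)
  open import Relation.Nullary.Decidable using (T?)

  open import Defs
  open Counting
  open Hall
  open Connectivity
  open EdgeNeighbourhood
  open Rationals
  open SubCouplings
  open +-*-Solver
  open Equivalence using (to)

  module _ {n : ℕ} (G : Graph n) where

    fromℕ*inv : ∀ {m} → 1 ℕ.≤ m → fromℕ m * inv G m ≡ 1ℚ
    fromℕ*inv {suc m} _ = ℚ.toℚᵘ-injective (begin
      toℚᵘ (fromℕ (suc m) * inv G (suc m))
        ≈⟨ ℚ.toℚᵘ-homo-* (fromℕ (suc m)) (inv G (suc m)) ⟩
      toℚᵘ (fromℕ (suc m)) ℚᵘ.* toℚᵘ (inv G (suc m))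
        ≈⟨ ℚᵘ.*-cong (ℚ.toℚᵘ-fromℚᵘ (ℚᵘ.mkℚᵘ (ℤ.+ suc m) 0)) (ℚ.toℚᵘ-fromℚᵘ (ℚᵘ.mkℚᵘ (ℤ.+ 1) m)) ⟩
      ℚᵘ.mkℚᵘ (ℤ.+ suc m) 0 ℚᵘ.* ℚᵘ.mkℚᵘ (ℤ.+ 1) m
        ≈⟨ ℚᵘ.*≡* cross-multiply ⟩
      toℚᵘ 1ℚ ∎)
      where
        open ℚᵘ.≃-Reasoning
        cross-multiply : (ℤ.+ suc m ℤ.* ℤ.+ 1) ℤ.* ℤ.+ 1 ≡ ℤ.+ 1 ℤ.* ℤ.+ (1 ℕ.* suc m)
        cross-multiply = trans (ℤ.*-identityʳ _) (trans (ℤ.*-identityʳ _)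
                           (sym (trans (ℤ.*-identityˡ _) (cong ℤ.+_ (ℕ.*-identityˡ (suc m))))))

    inv-nonNeg : ∀ m → 0ℚ ≤ inv G m
    inv-nonNeg zero    = ℚ.≤-refl
    inv-nonNeg (suc m) = ℚ.nonNegative⁻¹ _ {{ℚ.normalize-nonNeg 1 (suc m)}}

    inv≤1 : ∀ {m} → 1 ℕ.≤ m → inv G m ≤ 1ℚ
    inv≤1 {m} 1≤m = subst₂ _≤_ (ℚ.*-identityʳ (inv G m)) (trans (ℚ.*-comm (inv G m) (fromℕ m)) (fromℕ*inv 1≤m))
                            (*-monoˡ-≤ (inv-nonNeg m) (fromℕ-mono-≤ 1≤m))

    inv-antitone : ∀ {a b} → 1 ℕ.≤ a → a ℕ.≤ b → inv G b ≤ inv G a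
    inv-antitone {a} {b} 1≤a a≤b = 0≤-⇒≤ (subst (0ℚ ≤_) (sym difference)
      (*-nonNeg (*-nonNeg (inv-nonNeg a) (inv-nonNeg b)) (≤⇒0≤- (fromℕ-mono-≤ a≤b))))
      where
        difference : inv G a - inv G b ≡ inv G a * inv G b * (fromℕ b - fromℕ a)
        difference = begin
          inv G a - inv G b
            ≡⟨ cong₂ _-_ (expand (inv G a) (ℕ.≤-trans 1≤a a≤b)) (expand (inv G b) 1≤a) ⟩
          inv G a * (fromℕ b * inv G b) - inv G b * (fromℕ a * inv G a)
            ≡⟨ solve 4 (λ x y a b → x :* (b :* y) :- y :* (a :* x) := x :* y :* (b :- a)) refl
                       (inv G a) (inv G b) (fromℕ a) (fromℕ b) ⟩
          inv G a * inv G b * (fromℕ b - fromℕ a) ∎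
          where
            open ≡-Reasoning
            expand : ∀ r {m} → 1 ℕ.≤ m → r ≡ r * (fromℕ m * inv G m)
            expand r 1≤m = trans (sym (ℚ.*-identityʳ r)) (cong (r *_) (sym (fromℕ*inv 1≤m)))

    μ≡when : ∀ p z v → μ G p z v ≡ p when ⁅ z ⁆ v + ((1ℚ - p) * inv G (deg G z)) when adj G z v
    μ≡when p z v with z ≟ v
    ... | yes refl =
      sym (trans (cong₂ _+_ (when-T {p} {⁅ z ⁆ z} (≡⇒∈⁅⁆ refl)) (cong (r when_) (irrefl G z))) (ℚ.+-identityʳ p))
      where
        r : ℚ
        r = (1ℚ - p) * inv G (deg G z)
    ... | no  z≢v  =
      sym (trans (cong (_+ r when adj G z v) (when-¬T {p} (z≢v ∘ sym ∘ ∈⁅⁆⇒≡))) (ℚ.+-identityˡ (r when adj G z v)))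
      where
        r : ℚ
        r = (1ℚ - p) * inv G (deg G z)

    ∑μ≡1 : ∀ p z → 1 ℕ.≤ deg G z → sum (μ G p z) ≡ 1ℚ
    ∑μ≡1 p z 1≤d = begin
      sum (μ G p z)
        ≡⟨ sum-cong-≗ (μ≡when p z) ⟩
      sum (λ v → p when ⁅ z ⁆ v + r when adj G z v)
        ≡⟨ ∑-distrib-+ (λ v → p when ⁅ z ⁆ v) (λ v → r when adj G z v) ⟩
      sum (λ v → p when ⁅ z ⁆ v) + sum (λ v → r when adj G z v)
        ≡⟨ cong₂ _+_ (sum-δ (λ _ → p) z) (sum-when (adj G z) r) ⟩
      p + fromℕ (count (adj G z)) * r
        ≡⟨ cong (λ c → p + fromℕ c * r) (deg≡count G z) ⟨
      p + fromℕ (deg G z) * ((1ℚ - p) * inv G (deg G z))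
        ≡⟨ solve 3 (λ p d i → p :+ d :* ((con 1ℚ :- p) :* i) := p :+ (con 1ℚ :- p) :* (d :* i)) refl
                   p (fromℕ (deg G z)) (inv G (deg G z)) ⟩
      p + (1ℚ - p) * (fromℕ (deg G z) * inv G (deg G z))
        ≡⟨ cong (λ c → p + (1ℚ - p) * c) (fromℕ*inv 1≤d) ⟩
      p + (1ℚ - p) * 1ℚ
        ≡⟨ solve 1 (λ p → p :+ (con 1ℚ :- p) :* con 1ℚ := con 1ℚ) refl p ⟩
      1ℚ ∎
      where
        open ≡-Reasoning
        r : ℚ
        r = (1ℚ - p) * inv G (deg G z)

  slack-identity : ∀ p iD iD′ ε K N c m D → D * iD ≡ 1ℚ →
    let e = 1ℚ - p ; q = e * iD ; q′ = e * iD′ in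
    (p - q′) + m * q + (1ℚ + 1ℚ) * (1ℚ - (q′ + q + c * q + (p - q′) + m * q))
      + e * (ε + (iD′ - iD) + ((N + 1ℚ + (c + c) + m) - (D + (K + K))) * iD)
    ≡ 1ℚ - e * ((K + K + (1ℚ + 1ℚ) - N) * iD - ε)
  slack-identity p iD iD′ ε K N c m D D*iD≡1 =
    trans (polynomial p iD iD′ ε K N c m D) (trans (cong (R +_) vanishes) (ℚ.+-identityʳ R))
    where
      R : ℚ
      R = 1ℚ - (1ℚ - p) * ((K + K + (1ℚ + 1ℚ) - N) * iD - ε)
      vanishes : (1ℚ - p) * (1ℚ - D * iD) ≡ 0ℚ
      vanishes = trans (cong (λ t → (1ℚ - p) * (1ℚ - t)) D*iD≡1)
                       (trans (cong ((1ℚ - p) *_) (ℚ.+-inverseʳ 1ℚ)) (ℚ.*-zeroʳ (1ℚ - p)))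
      polynomial : ∀ p iD iD′ ε K N c m D →
        let e = 1ℚ - p ; q = e * iD ; q′ = e * iD′ in
        (p - q′) + m * q + (1ℚ + 1ℚ) * (1ℚ - (q′ + q + c * q + (p - q′) + m * q))
          + e * (ε + (iD′ - iD) + ((N + 1ℚ + (c + c) + m) - (D + (K + K))) * iD)
        ≡ 1ℚ - e * ((K + K + (1ℚ + 1ℚ) - N) * iD - ε) + e * (1ℚ - D * iD)
      polynomial = solve 9 (λ p iD iD′ ε K N c m D →
        let e = con 1ℚ :- p ; q = e :* iD ; q′ = e :* iD′ ; one = con 1ℚ in
        (p :- q′) :+ m :* q :+ (one :+ one) :* (one :- (q′ :+ q :+ c :* q :+ (p :- q′) :+ m :* q))
          :+ e :* (ε :+ (iD′ :- iD) :+ ((N :+ one :+ (c :+ c) :+ m) :- (D :+ (K :+ K))) :* iD)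
        := one :- e :* ((K :+ K :+ (one :+ one) :- N) :* iD :- ε) :+ e :* (one :- D :* iD)) refl

  module EdgePlan {n : ℕ} (G : Graph n) {k : ℕ} (ic : IsConnectivity G k) (n∸1≤2k : n ∸ 1 ℕ.≤ 2 ℕ.* k)
           {x y : Fin n} (xy : T (adj G x y)) (dyx : deg G y ℕ.≤ deg G x) {p : ℚ} (½≤p : ½ ≤ p) (p<1 : p < 1ℚ) where

    private
      A : Fin n → Fin n → Bool
      A = adj G
      yx : T (A y x)
      yx = subst T (adj-sym G x y) xy
      M C Aˣ Bʸ : Fin n → Bool
      M  = Matching.domain (matched G ic xy)
      C  = common G ic xy
      Aˣ = privateX G ic xy
      Bʸ = privateY G ic xy
      M⊆Aˣ : M ⊆ Aˣ
      M⊆Aˣ = Matching.domain⊆A (matched G ic xy)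
      f : Fin n → Fin n
      f = Matching.partner (matched G ic xy)

    e q q′ : ℚ
    e  = 1ℚ - p
    q  = e * inv G (deg G x)
    q′ = e * inv G (deg G y)

    0≤e : 0ℚ ≤ e
    0≤e = ≤⇒0≤- (ℚ.<⇒≤ p<1)

    0≤q : 0ℚ ≤ q
    0≤q = *-nonNeg 0≤e (inv-nonNeg G (deg G x))

    0≤q′ : 0ℚ ≤ q′
    0≤q′ = *-nonNeg 0≤e (inv-nonNeg G (deg G y))

    q≤q′ : q ≤ q′
    q≤q′ = *-monoˡ-≤ 0≤e (inv-antitone G (adj⇒1≤deg G yx) dyx)

    q′≤p : q′ ≤ p
    q′≤p = begin
      e * inv G (deg G y)   ≤⟨ *-monoˡ-≤ 0≤e (inv≤1 G (adj⇒1≤deg G yx)) ⟩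
      e * 1ℚ                ≡⟨ ℚ.*-identityʳ e ⟩
      1ℚ - p                ≤⟨ ℚ.+-monoʳ-≤ 1ℚ (ℚ.neg-antimono-≤ ½≤p) ⟩
      1ℚ - ½                ≡⟨ refl ⟩
      ½                     ≤⟨ ½≤p ⟩
      p                     ∎
      where open ℚ.≤-Reasoning

    stay : Fin n → ℚ
    stay u = q′ when ⁅ x ⁆ u + q when ⁅ y ⁆ u + q when C u

    move match plan : Fin n → Fin n → ℚ
    move u v  = (p - q′) when (⁅ x ⁆ u ∧ ⁅ y ⁆ v)
    match u v = q when (M u ∧ ⁅ f u ⁆ v)
    plan u v  = stay u when ⁅ u ⁆ v + move u v + match u v

    image : Fin n → ℚ
    image v = sum (λ u → match u v)

    ∑move : ∀ u → sum (move u) ≡ (p - q′) when ⁅ x ⁆ u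
    ∑move u = trans (sum-cong-≗ λ v → when-∧ (p - q′) (⁅ x ⁆ u) (⁅ y ⁆ v)) (sum-δ (λ _ → (p - q′) when ⁅ x ⁆ u) y)

    ∑match : ∀ u → sum (match u) ≡ q when M u
    ∑match u = trans (sum-cong-≗ λ v → when-∧ q (M u) (⁅ f u ⁆ v)) (sum-δ (λ _ → q when M u) (f u))

    ∑move′ : ∀ v → sum (λ u → move u v) ≡ (p - q′) when ⁅ y ⁆ v
    ∑move′ v = trans (sum-cong-≗ swap) (sum-δ (λ _ → (p - q′) when ⁅ y ⁆ v) x)
      where
        swap : ∀ u → move u v ≡ ((p - q′) when ⁅ y ⁆ v) when ⁅ x ⁆ u
        swap u = trans (cong ((p - q′) when_) (∧-comm (⁅ x ⁆ u) (⁅ y ⁆ v))) (when-∧ (p - q′) (⁅ y ⁆ v) (⁅ x ⁆ u))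

    plan-rows : ∀ u → sum (plan u) ≡ stay u + (p - q′) when ⁅ x ⁆ u + q when M u
    plan-rows u = begin
      sum (plan u)
        ≡⟨ ∑-distrib-+ (λ v → diagonal v + move u v) (match u) ⟩
      sum (λ v → diagonal v + move u v) + sum (match u)
        ≡⟨ cong (_+ sum (match u)) (∑-distrib-+ diagonal (move u)) ⟩
      sum diagonal + sum (move u) + sum (match u)
        ≡⟨ cong₂ (λ s t → s + t + sum (match u)) (sum-δ (λ _ → stay u) u) (∑move u) ⟩
      stay u + (p - q′) when ⁅ x ⁆ u + sum (match u)
        ≡⟨ cong (stay u + (p - q′) when ⁅ x ⁆ u +_) (∑match u) ⟩
      stay u + (p - q′) when ⁅ x ⁆ u + q when M u ∎
      where
        open ≡-Reasoning
        diagonal : Fin n → ℚ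
        diagonal v = stay u when ⁅ u ⁆ v

    plan-cols : ∀ v → sum (λ u → plan u v) ≡ stay v + (p - q′) when ⁅ y ⁆ v + image v
    plan-cols v = begin
      sum (λ u → plan u v)
        ≡⟨ ∑-distrib-+ (λ u → diagonal u + move u v) (λ u → match u v) ⟩
      sum (λ u → diagonal u + move u v) + image v
        ≡⟨ cong (_+ image v) (∑-distrib-+ diagonal (λ u → move u v)) ⟩
      sum diagonal + sum (λ u → move u v) + image v
        ≡⟨ cong₂ (λ s t → s + t + image v) (sum-δ′ stay v) (∑move′ v) ⟩
      stay v + (p - q′) when ⁅ y ⁆ v + image v ∎
      where
        open ≡-Reasoning
        diagonal : Fin n → ℚ
        diagonal u = stay u when ⁅ u ⁆ v

    image≤ : ∀ v → image v ≤ q when Bʸ v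
    image≤ v = begin
      image v                          ≡⟨ sum-when (λ u → M u ∧ ⁅ f u ⁆ v) q ⟩
      fromℕ (count preimage) * q      ≤⟨ ℚ.*-monoʳ-≤-nonNeg q {{nonNegative 0≤q}} (fromℕ-mono-≤ preimage≤) ⟩
      fromℕ (indicator (Bʸ v)) * q     ≡⟨ when≡fromℕ* q (Bʸ v) ⟨
      q when Bʸ v                      ∎
      where
        open ℚ.≤-Reasoning
        open Matching (matched G ic xy)
        preimage : Fin n → Bool
        preimage u = M u ∧ ⁅ f u ⁆ v
        unpack : ∀ {u} → T (preimage u) → T (M u) × v ≡ f u
        unpack {u} h = T-∧ {M u} .to h .proj₁ , ∈⁅⁆⇒≡ (T-∧ {M u} .to h .proj₂)
        preimage≤ : count preimage ℕ.≤ indicator (Bʸ v)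
        preimage≤ with any? (λ u → T? (preimage u))
        ... | no  none      = ℕ.≤-trans (ℕ.≤-reflexive (count-∅ preimage λ u h → none (u , h))) z≤n
        ... | yes (u₀ , h₀) = subst (count preimage ℕ.≤_) (sym (indicator-true Bv)) (count≤1 preimage unique)
          where
            Bv : T (Bʸ v)
            Bv = subst (T ∘ Bʸ) (sym (unpack {u₀} h₀ .proj₂)) (partner∈B u₀ (unpack {u₀} h₀ .proj₁))
            unique : ∀ i j → T (preimage i) → T (preimage j) → i ≡ j
            unique i j hi hj = injective i j (unpack {i} hi .proj₁) (unpack {j} hj .proj₁)
                                           (trans (sym (unpack {i} hi .proj₂)) (unpack {j} hj .proj₂))

    rows≤ : ∀ u → sum (plan u) ≤ μ G p x u
    rows≤ u = begin
      sum (plan u)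
        ≡⟨ plan-rows u ⟩
      q′ when X + q when Y + q when Cu + (p - q′) when X + q when Mu
        ≡⟨ regroup (q′ when X) (q when Y) (q when Cu) ((p - q′) when X) (q when Mu) ⟩
      (q′ when X + (p - q′) when X) + (q when Y + (q when Cu + q when Mu))
        ≡⟨ cong₂ _+_ (sym (when-+ q′ (p - q′) X)) (cong (q when Y +_) (sym (when-∨ q C∩M=∅))) ⟩
      (q′ + (p - q′)) when X + (q when Y + q when (Cu ∨ Mu))
        ≡⟨ cong₂ _+_ (cong (_when X) (solve 2 (λ a b → a :+ (b :- a) := b) refl q′ p)) (sym (when-∨ q y∩CM=∅)) ⟩
      p when X + q when (Y ∨ (Cu ∨ Mu))
        ≤⟨ ℚ.+-monoʳ-≤ (p when X) (when-⊆ 0≤q ⊆Ax) ⟩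
      p when X + q when A x u
        ≡⟨ μ≡when G p x u ⟨
      μ G p x u ∎
      where
        open ℚ.≤-Reasoning
        X Y Cu Mu : Bool
        X = ⁅ x ⁆ u
        Y = ⁅ y ⁆ u
        Cu = C u
        Mu = M u
        regroup : ∀ a b c d e → a + b + c + d + e ≡ (a + d) + (b + (c + e))
        regroup = solve 5 (λ a b c d e → a :+ b :+ c :+ d :+ e := (a :+ d) :+ (b :+ (c :+ e))) refl
        C∩M=∅ : T Cu → ¬ T Mu
        C∩M=∅ Cu Mu = ─N[]⇒¬adj G {A x} (M⊆Aˣ u Mu) (T-∧ {A x u} .to Cu .proj₂)
        y∩CM=∅ : T Y → ¬ T (Cu ∨ Mu)
        y∩CM=∅ u=y CMu with T-∨ {Cu} .to CMu
        ... | inj₁ Cu = subst T (irrefl G y) (subst (T ∘ A y) (∈⁅⁆⇒≡ u=y) (T-∧ {A x u} .to Cu .proj₂))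
        ... | inj₂ Mu = y∉privateX G ic xy (subst (T ∘ Aˣ) (∈⁅⁆⇒≡ u=y) (M⊆Aˣ u Mu))
        ⊆Ax : T (Y ∨ (Cu ∨ Mu)) → T (A x u)
        ⊆Ax h with T-∨ {Y} .to h
        ... | inj₁ u=y = subst (T ∘ A x) (sym (∈⁅⁆⇒≡ u=y)) xy
        ... | inj₂ CMu with T-∨ {Cu} .to CMu
        ...   | inj₁ Cu = T-∧ {A x u} .to Cu .proj₁
        ...   | inj₂ Mu = T-∧ {A x u} .to (M⊆Aˣ u Mu) .proj₁

    cols≤ : ∀ v → sum (λ u → plan u v) ≤ μ G p y v
    cols≤ v = begin
      sum (λ u → plan u v)
        ≡⟨ plan-cols v ⟩
      stay v + (p - q′) when Y + image v
        ≤⟨ ℚ.+-monoʳ-≤ (stay v + (p - q′) when Y) (image≤ v) ⟩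
      q′ when X + q when Y + q when Cv + (p - q′) when Y + q when Bv
        ≡⟨ regroup (q′ when X) (q when Y) (q when Cv) ((p - q′) when Y) (q when Bv) ⟩
      (q when Y + (p - q′) when Y) + (q′ when X + (q when Cv + q when Bv))
        ≡⟨ cong₂ _+_ (sym (when-+ q (p - q′) Y)) (cong (q′ when X +_) (sym (when-∨ q C∩B=∅))) ⟩
      (q + (p - q′)) when Y + (q′ when X + q when (Cv ∨ Bv))
        ≤⟨ ℚ.+-mono-≤ (when-mono-≤ Y q+[p-q′]≤p) (ℚ.+-monoʳ-≤ (q′ when X) (when-mono-≤ (Cv ∨ Bv) q≤q′)) ⟩
      p when Y + (q′ when X + q′ when (Cv ∨ Bv))
        ≡⟨ cong (p when Y +_) (sym (when-∨ q′ x∩CB=∅)) ⟩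
      p when Y + q′ when (X ∨ (Cv ∨ Bv))
        ≤⟨ ℚ.+-monoʳ-≤ (p when Y) (when-⊆ 0≤q′ ⊆Ay) ⟩
      p when Y + q′ when A y v
        ≡⟨ μ≡when G p y v ⟨
      μ G p y v ∎
      where
        open ℚ.≤-Reasoning
        X Y Cv Bv : Bool
        X = ⁅ x ⁆ v
        Y = ⁅ y ⁆ v
        Cv = C v
        Bv = Bʸ v
        regroup : ∀ a b c d e → a + b + c + d + e ≡ (b + d) + (a + (c + e))
        regroup = solve 5 (λ a b c d e → a :+ b :+ c :+ d :+ e := (b :+ d) :+ (a :+ (c :+ e))) refl
        q+[p-q′]≤p : q + (p - q′) ≤ p
        q+[p-q′]≤p = subst (q + (p - q′) ≤_) (solve 2 (λ a b → a :+ (b :- a) := b) refl q′ p) (ℚ.+-monoˡ-≤ (p - q′) q≤q′)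
        C∩B=∅ : T Cv → ¬ T Bv
        C∩B=∅ Cv Bv = ─N[]⇒¬adj G {A y} Bv (T-∧ {A x v} .to Cv .proj₁)
        x∩CB=∅ : T X → ¬ T (Cv ∨ Bv)
        x∩CB=∅ v=x CBv with T-∨ {Cv} .to CBv
        ... | inj₁ Cv = subst T (irrefl G x) (subst (T ∘ A x) (∈⁅⁆⇒≡ v=x) (T-∧ {A x v} .to Cv .proj₁))
        ... | inj₂ Bv = x∉privateY G ic xy (subst (T ∘ Bʸ) (∈⁅⁆⇒≡ v=x) Bv)
        ⊆Ay : T (X ∨ (Cv ∨ Bv)) → T (A y v)
        ⊆Ay h with T-∨ {X} .to h
        ... | inj₁ v=x = subst (T ∘ A y) (sym (∈⁅⁆⇒≡ v=x)) yx
        ... | inj₂ CBv with T-∨ {Cv} .to CBv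
        ...   | inj₁ Cv = T-∧ {A x v} .to Cv .proj₂
        ...   | inj₂ Bv = T-∧ {A y v} .to Bv .proj₁

    plan-nonNeg : ∀ u v → 0ℚ ≤ plan u v
    plan-nonNeg u v = +-nonNeg (+-nonNeg (when-nonNeg (⁅ u ⁆ v) stay-nonNeg) (when-nonNeg (⁅ x ⁆ u ∧ ⁅ y ⁆ v) (≤⇒0≤- q′≤p)))
                               (when-nonNeg (M u ∧ ⁅ f u ⁆ v) 0≤q)
      where
        stay-nonNeg : 0ℚ ≤ stay u
        stay-nonNeg = +-nonNeg (+-nonNeg (when-nonNeg (⁅ x ⁆ u) 0≤q′) (when-nonNeg (⁅ y ⁆ u) 0≤q)) (when-nonNeg (C u) 0≤q)

    subCoupling : SubCoupling G (μ G p x) (μ G p y) plan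
    subCoupling = record { nonNeg = plan-nonNeg ; rows≤ = rows≤ ; cols≤ = cols≤ }

    c m : ℚ
    c = fromℕ (count C)
    m = fromℕ (count M)

    plan-mass : mass G plan ≡ q′ + q + c * q + (p - q′) + m * q
    plan-mass = begin
      sum (λ u → sum (plan u))
        ≡⟨ sum-cong-≗ plan-rows ⟩
      sum (λ u → stay u + toY u + matchedMass u)
        ≡⟨ ∑-distrib-+ (λ u → stay u + toY u) matchedMass ⟩
      sum (λ u → stay u + toY u) + sum matchedMass
        ≡⟨ cong (_+ sum matchedMass) (∑-distrib-+ stay toY) ⟩
      sum stay + sum toY + sum matchedMass
        ≡⟨ cong₂ (λ s t → s + t + sum matchedMass) ∑stay (sum-δ (λ _ → p - q′) x) ⟩
      q′ + q + c * q + (p - q′) + sum matchedMass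
        ≡⟨ cong (q′ + q + c * q + (p - q′) +_) (sum-when M q) ⟩
      q′ + q + c * q + (p - q′) + m * q ∎
      where
        open ≡-Reasoning
        toY matchedMass : Fin n → ℚ
        toY u = (p - q′) when ⁅ x ⁆ u
        matchedMass u = q when M u
        ∑stay : sum stay ≡ q′ + q + c * q
        ∑stay = begin
          sum stay
            ≡⟨ ∑-distrib-+ (λ u → q′ when ⁅ x ⁆ u + q when ⁅ y ⁆ u) (λ u → q when C u) ⟩
          sum (λ u → q′ when ⁅ x ⁆ u + q when ⁅ y ⁆ u) + sum (λ u → q when C u)
            ≡⟨ cong₂ _+_ (∑-distrib-+ (λ u → q′ when ⁅ x ⁆ u) (λ u → q when ⁅ y ⁆ u)) (sum-when C q) ⟩
          sum (λ u → q′ when ⁅ x ⁆ u) + sum (λ u → q when ⁅ y ⁆ u) + c * q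
            ≡⟨ cong₂ (λ s t → s + t + c * q) (sum-δ (λ _ → q′) x) (sum-δ (λ _ → q) y) ⟩
          q′ + q + c * q ∎

    plan-cost-pointwise : ∀ u v → fromℕ (dist G u v) * plan u v ≤ move u v + match u v
    plan-cost-pointwise u v = begin
      d * plan u v
        ≡⟨ solve 4 (λ D a b c → D :* (a :+ b :+ c) := D :* a :+ D :* b :+ D :* c) refl
                   d (stay u when ⁅ u ⁆ v) (move u v) (match u v) ⟩
      d * (stay u when ⁅ u ⁆ v) + d * move u v + d * match u v
        ≤⟨ ℚ.+-mono-≤ (ℚ.+-mono-≤ (ℚ.≤-reflexive (*-when-0 (⁅ u ⁆ v) stays))
                                  (*-when-≤ (⁅ x ⁆ u ∧ ⁅ y ⁆ v) (≤⇒0≤- q′≤p) moves))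
                      (*-when-≤ (M u ∧ ⁅ f u ⁆ v) 0≤q matches) ⟩
      0ℚ + move u v + match u v
        ≡⟨ cong (_+ match u v) (ℚ.+-identityˡ (move u v)) ⟩
      move u v + match u v ∎
      where
        open ℚ.≤-Reasoning
        d : ℚ
        d = fromℕ (dist G u v)
        stays : T (⁅ u ⁆ v) → d ≡ 0ℚ
        stays v=u = cong fromℕ (trans (cong (dist G u) (∈⁅⁆⇒≡ v=u)) (dist-refl G u))
        moves : T (⁅ x ⁆ u ∧ ⁅ y ⁆ v) → d ≤ 1ℚ
        moves h = ℚ.≤-reflexive (cong fromℕ (trans (cong₂ (dist G) u=x v=y) (dist-adj G xy)))
          where
            u=x : u ≡ x
            u=x = ∈⁅⁆⇒≡ (T-∧ .to h .proj₁)
            v=y : v ≡ y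
            v=y = ∈⁅⁆⇒≡ (T-∧ .to h .proj₂)
        matches : T (M u ∧ ⁅ f u ⁆ v) → d ≤ 1ℚ
        matches h = ℚ.≤-reflexive (cong fromℕ (trans (cong (dist G u) v=fu)
                                                     (dist-adj G (Matching.related (matched G ic xy) u Mu))))
          where
            Mu : T (M u)
            Mu = T-∧ {M u} .to h .proj₁
            v=fu : v ≡ f u
            v=fu = ∈⁅⁆⇒≡ (T-∧ {M u} .to h .proj₂)

    plan-cost : cost G plan ≤ (p - q′) + m * q
    plan-cost = begin
      cost G plan
        ≡⟨ cost≡ G plan ⟩
      sum (λ u → sum (λ v → fromℕ (dist G u v) * plan u v))
        ≤⟨ sum-mono-≤ (λ u → sum-mono-≤ (plan-cost-pointwise u)) ⟩
      sum (λ u → sum (λ v → move u v + match u v))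
        ≡⟨ sum-cong-≗ (λ u → ∑-distrib-+ (move u) (match u)) ⟩
      sum (λ u → sum (move u) + sum (match u))
        ≡⟨ sum-cong-≗ (λ u → cong₂ _+_ (∑move u) (∑match u)) ⟩
      sum (λ u → (p - q′) when ⁅ x ⁆ u + q when M u)
        ≡⟨ ∑-distrib-+ (λ u → (p - q′) when ⁅ x ⁆ u) (λ u → q when M u) ⟩
      sum (λ u → (p - q′) when ⁅ x ⁆ u) + sum (λ u → q when M u)
        ≡⟨ cong₂ _+_ (sum-δ (λ _ → p - q′) x) (sum-when M q) ⟩
      (p - q′) + m * q ∎
      where open ℚ.≤-Reasoning

    open Completion G (∑μ≡1 G p x (adj⇒1≤deg G xy)) (∑μ≡1 G p y (adj⇒1≤deg G yx)) subCoupling public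
      using (π; isCoupling)
    open Completion G (∑μ≡1 G p x (adj⇒1≤deg G xy)) (∑μ≡1 G p y (adj⇒1≤deg G yx)) subCoupling
      using (cost-≤)

    transport-cost : cost G π ≤ (p - q′) + m * q + (1ℚ + 1ℚ) * (1ℚ - (q′ + q + c * q + (p - q′) + m * q))
    transport-cost = begin
      cost G π
        ≤⟨ cost-≤ (diameter≤2 G ic n∸1≤2k) ⟩
      cost G plan + fromℕ 2 * (1ℚ - mass G plan)
        ≤⟨ ℚ.+-monoˡ-≤ (fromℕ 2 * (1ℚ - mass G plan)) plan-cost ⟩
      (p - q′) + m * q + fromℕ 2 * (1ℚ - mass G plan)
        ≡⟨ cong₂ (λ two t → (p - q′) + m * q + two * (1ℚ - t)) (fromℕ-+ 1 1) plan-mass ⟩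
      (p - q′) + m * q + (1ℚ + 1ℚ) * (1ℚ - (q′ + q + c * q + (p - q′) + m * q)) ∎
      where open ℚ.≤-Reasoning

    private
      D K N iD iD′ : ℚ
      D   = fromℕ (deg G x)
      K   = fromℕ k
      N   = fromℕ n
      iD  = inv G (deg G x)
      iD′ = inv G (deg G y)

    key-inequalityℚ : D + (K + K) ≤ N + 1ℚ + (c + c) + m
    key-inequalityℚ = subst₂ _≤_ lhs rhs (fromℕ-mono-≤ (key-inequality G ic xy))
      where
        lhs : fromℕ (deg G x ℕ.+ 2 ℕ.* k) ≡ D + (K + K)
        lhs = trans (fromℕ-+ (deg G x) (2 ℕ.* k)) (cong (D +_) (fromℕ-2* k))
        rhs : fromℕ (n ℕ.+ 1 ℕ.+ 2 ℕ.* count C ℕ.+ count M) ≡ N + 1ℚ + (c + c) + m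
        rhs = begin
          fromℕ (n ℕ.+ 1 ℕ.+ 2 ℕ.* count C ℕ.+ count M)
            ≡⟨ fromℕ-+ (n ℕ.+ 1 ℕ.+ 2 ℕ.* count C) (count M) ⟩
          fromℕ (n ℕ.+ 1 ℕ.+ 2 ℕ.* count C) + m
            ≡⟨ cong (_+ m) (fromℕ-+ (n ℕ.+ 1) (2 ℕ.* count C)) ⟩
          fromℕ (n ℕ.+ 1) + fromℕ (2 ℕ.* count C) + m
            ≡⟨ cong₂ (λ a b → a + b + m) (fromℕ-+ n 1) (fromℕ-2* (count C)) ⟩
          N + 1ℚ + (c + c) + m ∎
          where open ≡-Reasoning

    cost-bound : ∀ ε → 0ℚ ≤ ε →
                 cost G π ≤ fromℕ (dist G x y) * (1ℚ - e * ((fromℕ (2 ℕ.* k ℕ.+ 2) - fromℕ n) * iD - ε))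
    cost-bound ε 0≤ε = begin
      cost G π
        ≤⟨ transport-cost ⟩
      bound
        ≤⟨ ≤-+-nonNeg (*-nonNeg 0≤e 0≤slack) ⟩
      bound + e * slack
        ≡⟨ slack-identity p iD iD′ ε K N c m D (fromℕ*inv G (adj⇒1≤deg G xy)) ⟩
      1ℚ - e * ((K + K + (1ℚ + 1ℚ) - N) * iD - ε)
        ≡⟨ ℚ.*-identityˡ _ ⟨
      1ℚ * (1ℚ - e * ((K + K + (1ℚ + 1ℚ) - N) * iD - ε))
        ≡⟨ cong₂ (λ d t → d * (1ℚ - e * ((t - N) * iD - ε))) (cong fromℕ (dist-adj G xy)) 2k+2≡ ⟨
      fromℕ (dist G x y) * (1ℚ - e * ((fromℕ (2 ℕ.* k ℕ.+ 2) - N) * iD - ε)) ∎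
      where
        open ℚ.≤-Reasoning
        bound slack : ℚ
        bound = (p - q′) + m * q + (1ℚ + 1ℚ) * (1ℚ - (q′ + q + c * q + (p - q′) + m * q))
        slack = ε + (iD′ - iD) + ((N + 1ℚ + (c + c) + m) - (D + (K + K))) * iD
        0≤slack : 0ℚ ≤ slack
        0≤slack = +-nonNeg (+-nonNeg 0≤ε (≤⇒0≤- (inv-antitone G (adj⇒1≤deg G yx) dyx)))
                           (*-nonNeg (≤⇒0≤- key-inequalityℚ) (inv-nonNeg G (deg G x)))
        2k+2≡ : fromℕ (2 ℕ.* k ℕ.+ 2) ≡ K + K + (1ℚ + 1ℚ)
        2k+2≡ = trans (fromℕ-+ (2 ℕ.* k) 2) (cong₂ _+_ (fromℕ-2* k) (fromℕ-+ 1 1))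

open import Defs
open import Data.Bool using (T)
open import Data.Nat as ℕ using (ℕ)
open import Data.Fin using (Fin)
open import Data.Product using (_×_; ∃-syntax; _,_)
open import Data.Rational using (ℚ; _<_; _≤_; _+_; _-_; _*_; 0ℚ; 1ℚ; ½)
import Data.Rational.Properties as ℚ

open EdgeTransport

theorem1p7 : (n : ℕ) (G : Graph n) (k : ℕ) → IsConnectivity G k →
  n ℕ.∸ 1 ℕ.≤ 2 ℕ.* k →
  (x y : Fin n) → T (adj G x y) → deg G y ℕ.≤ deg G x →
  -- liminf_{p → 1⁻} κ_p(x,y)/(1-p) ≥ B, with B = (2k(G) - n + 2)/d_x, i.e.
  -- ∀ ε > 0 ∃ δ > 0 ∀ p ∈ [0,1) ∩ (1-δ,1) : W(μ_x^p, μ_y^p) ≤ d(x,y)·(1 - (1-p)(B - ε))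
  (ε : ℚ) → 0ℚ < ε →
  ∃[ δ ] (0ℚ < δ ×
    ((p : ℚ) → 0ℚ ≤ p → 1ℚ - δ < p → p < 1ℚ →
      ∃[ π ] (IsCoupling G (μ G p x) (μ G p y) π ×
        cost G π ≤ ℕtoℚ G (dist G x y) *
          (1ℚ - (1ℚ - p) * ((ℕtoℚ G (2 ℕ.* k ℕ.+ 2) - ℕtoℚ G n) * inv G (deg G x) - ε)))))
-- δ = 1/2: for p ≥ 1/2 the mass p - (1-p)/d_y that the plan moves from x to y is nonnegative.
theorem1p7 n G k ic n∸1≤2k x y xy dyx ε 0<ε = ½ , ℚ.positive⁻¹ ½ , λ p _ ½<p p<1 →
  let open EdgePlan G ic n∸1≤2k xy dyx (ℚ.<⇒≤ ½<p) p<1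
  in  π , isCoupling , cost-bound ε (ℚ.<⇒≤ 0<ε)
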